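{- Let $u\ge 1$ and $m\ge k\ge 2$ be integers. If $a_1,\ldots,a_m$ are sampled independently and uniformly at random from the integer interval $[-u,u]$, and $E_k$ is the event that there exist distinct indices $i_1,\ldots,i_k$ with $a_{i_1}+\cdots+a_{i_k}=0$, then $$1-e^{ -\alpha}\ \le\ \Pr[E_k]\ \le\ \binom{m}{k}\Big/(2u+1),$$ where $$\alpha := \frac{1}{4k+2}\cdot\Big\lfloor \frac{m}{k(20u+10)^{1/k}}\Big\rfloor.$$ -}

module Defs where

open import Data.Bool using (Bool; true; false; _∧_)
open import Data.Nat as ℕ using (ℕ; zero; suc; _^_; _≡ᵇ_)
import Data.Nat.Properties as ℕP
open import Data.Integer as ℤ using (ℤ; +_)
open import Data.List using (List; []; _∷_; _++_; map; concatMap; upTo; length; filter; foldr)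
open import Data.Bool.ListAction using (any)
open import Data.Rational as ℚ using (ℚ; _/_; 1ℚ; 0ℚ)
open import Relation.Nullary using (does)
open import Data.Bool.Properties using (T?)

interval : ℕ → List ℤ
interval u = map (λ i → + i ℤ.- + u) (upTo (suc (2 ℕ.* u)))

samples : ℕ → ℕ → List (List ℤ)
samples u zero    = [] ∷ []
samples u (suc m) = concatMap (λ x → map (x ∷_) (samples u m)) (interval u)

-- All sub-selections of entries at distinct index sets (one list per subset of indices).
subselections : List ℤ → List (List ℤ)
subselections []       = [] ∷ []
subselections (x ∷ xs) = map (x ∷_) (subselections xs) ++ subselections xs

sumℤ : List ℤ → ℤ
sumℤ = foldr ℤ._+_ (+ 0)

E : ℕ → List ℤ → Bool
E k a = any (λ s → (length s ≡ᵇ k) ∧ does (sumℤ s ℤ.≟ + 0)) (subselections a)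

countE : ℕ → ℕ → ℕ → ℕ
countE u m k = length (filter (λ a → T? (E k a)) (samples u m))

PrE : ℕ → ℕ → ℕ → ℚ
PrE u m k = _/_ (+ countE u m k) ((suc (2 ℕ.* u)) ^ m) {{ℕP.m^n≢0 (suc (2 ℕ.* u)) m}}

expTerm : ℚ → ℕ → ℚ
expTerm x zero    = 1ℚ
expTerm x (suc j) = expTerm x j ℚ.* x ℚ.* (+ 1 / suc j)

expPartial : ℚ → ℕ → ℚ
expPartial x zero    = 0ℚ
expPartial x (suc N) = expPartial x N ℚ.+ expTerm x N

-- Upper bound: a fixed set of k indices has zero sum with probability at most 1/(2u+1),
-- since its last entry is determined by the others; there are C(m,k) such sets.
--
-- Lower bound: cut the m entries into q blocks of length n = ⌊m/q⌋; the hypothesis on q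
-- gives C(n,k) ≥ 2u+1.  In one block let X count the zero-sum k-subsets.  A sum of k
-- uniform entries of [-u,u] is symmetric and unimodal on 2ku+1 values, so
-- E X ≥ C(n,k)/(2ku+1); two distinct k-subsets are both zero-sum with probability at most
-- 1/(2u+1) times that of one of them, so E X² ≤ (1 + C(n,k)/(2u+1)) E X.  The second-moment
-- bound Pr[X > 0] ≥ (E X)²/E X² gives Pr[E_k in a block] ≥ 1/(2k).  E_k fails only if it
-- fails in every block, so 1 - Pr[E_k] ≤ ρ^q with ρ = (4k+1)/(4k+2); finally ρ^q e^α ≤ 1
-- because the exponential series of α = q(1-ρ) is dominated termwise by the binomial
-- series of ρ^(-q) = (1-(1-ρ))^(-q).

module Submission where

import Data.Bool as Bool
open Bool using (Bool; true; false; not; _∧_; T)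
open import Data.Bool.ListAction using (any)
open import Data.Bool.Properties using (T?)
open import Data.Empty using (⊥; ⊥-elim)
open import Data.Integer as ℤ using (ℤ; ∣_∣)
import Data.Integer.Properties as ℤP
open import Data.Integer.Tactic.RingSolver using () renaming (solve-∀ to ℤ-solve-∀)
open import Data.List using (List; []; _∷_; _++_; map; concat; applyUpTo; upTo; filter; length)
open import Data.List.Membership.Propositional using (_∈_)
open import Data.List.Membership.Propositional.Properties using (∈-++⁺ʳ)
open import Data.List.Properties using (map-++; map-∘; ≡-dec)
open import Data.List.Relation.Binary.Subset.Propositional using (_⊆_)
open import Data.List.Relation.Binary.Subset.Propositional.Properties
  using (⊆-refl; ⊆-trans; ++⁺; map⁺; xs⊆ys++xs; Any-resp-⊆)
open import Data.List.Relation.Unary.Any using (here; there)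
open import Data.List.Relation.Unary.Any.Properties using (any⁺; any⁻)
open import Data.Nat as ℕ
  using (ℕ; zero; suc; _+_; _*_; _∸_; _^_; _≤_; _<_; z≤n; s≤s; _≤′_; ≤′-refl; ≤′-step; _≡ᵇ_; _≤?_)
open import Data.Nat.Combinatorics using (_C_; nCk+nC[k+1]≡[n+1]C[k+1]; nCn≡1; nC1≡n; k>n⇒nCk≡0)
import Data.Nat.DivMod as ℕ
open import Data.Nat.Properties
open import Data.Nat.Tactic.RingSolver using (solve-∀)
open import Algebra.Properties.CommutativeSemigroup +-commutativeSemigroup using (interchange)
open import Data.Product using (∃-syntax; _×_; _,_)
open import Data.Rational as ℚ using (ℚ; _/_; 0ℚ; 1ℚ; toℚᵘ)
import Data.Rational.Properties as ℚP
import Data.Rational.Unnormalised as ℚᵘ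
import Data.Rational.Unnormalised.Properties as ℚᵘP
open import Data.Sum using ([_,_]′)
open import Data.Unit using (⊤; tt)
open import Function using (_∘_)
open import Level using (0ℓ)
open import Relation.Binary.PropositionalEquality
open import Relation.Nullary using (Dec; does; yes; no)
open import Relation.Nullary.Decidable using (dec⇒maybe)
open import Relation.Nullary.Negation using (contradiction)
open import Tactic.RingSolver using () renaming (solve-∀ to ℚ-solve-∀)
open import Tactic.RingSolver.Core.AlmostCommutativeRing using (AlmostCommutativeRing; fromCommutativeRing)

open import Defs

-- Finite sums

Σ< : ℕ → (ℕ → ℕ) → ℕ
Σ< zero    f = 0
Σ< (suc n) f = f 0 + Σ< n (f ∘ suc)

Σ<-mono : ∀ n {f g : ℕ → ℕ} → (∀ i → i < n → f i ≤ g i) → Σ< n f ≤ Σ< n g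
Σ<-mono zero    f≤g = z≤n
Σ<-mono (suc n) f≤g = +-mono-≤ (f≤g 0 (s≤s z≤n)) (Σ<-mono n (λ i i<n → f≤g (suc i) (s≤s i<n)))

Σ<-cong : ∀ n {f g : ℕ → ℕ} → (∀ i → i < n → f i ≡ g i) → Σ< n f ≡ Σ< n g
Σ<-cong n f≡g = ≤-antisym (Σ<-mono n (λ i i<n → ≤-reflexive (f≡g i i<n)))
                          (Σ<-mono n (λ i i<n → ≤-reflexive (sym (f≡g i i<n))))

Σ<-+ : ∀ n (f g : ℕ → ℕ) → Σ< n (λ i → f i + g i) ≡ Σ< n f + Σ< n g
Σ<-+ zero    f g = refl
Σ<-+ (suc n) f g = trans (cong ((f 0 + g 0) +_) (Σ<-+ n (f ∘ suc) (g ∘ suc)))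
                         (interchange (f 0) (g 0) (Σ< n (f ∘ suc)) (Σ< n (g ∘ suc)))

Σ<-*ˡ : ∀ n c (f : ℕ → ℕ) → Σ< n (λ i → c * f i) ≡ c * Σ< n f
Σ<-*ˡ zero    c f = sym (*-zeroʳ c)
Σ<-*ˡ (suc n) c f = trans (cong (c * f 0 +_) (Σ<-*ˡ n c (f ∘ suc))) (sym (*-distribˡ-+ c (f 0) _))

Σ<-const : ∀ n c → Σ< n (λ _ → c) ≡ n * c
Σ<-const zero    c = refl
Σ<-const (suc n) c = cong (c +_) (Σ<-const n c)

Σ<-snoc : ∀ n (f : ℕ → ℕ) → Σ< (suc n) f ≡ Σ< n f + f n
Σ<-snoc zero    f = +-comm (f 0) 0
Σ<-snoc (suc n) f = trans (cong (f 0 +_) (Σ<-snoc n (f ∘ suc))) (sym (+-assoc (f 0) _ _))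

≤Σ< : ∀ n (f : ℕ → ℕ) {i} → i < n → f i ≤ Σ< n f
≤Σ< (suc n) f {zero}  _         = m≤m+n (f 0) _
≤Σ< (suc n) f {suc i} (s≤s i<n) = ≤-trans (≤Σ< n (f ∘ suc) i<n) (m≤n+m _ (f 0))

Σ<-comm : ∀ a b (f : ℕ → ℕ → ℕ) → Σ< a (λ i → Σ< b (f i)) ≡ Σ< b (λ j → Σ< a (λ i → f i j))
Σ<-comm zero    b f = sym (trans (Σ<-const b 0) (*-zeroʳ b))
Σ<-comm (suc a) b f = trans (cong (Σ< b (f 0) +_) (Σ<-comm a b (f ∘ suc)))
                            (sym (Σ<-+ b (f 0) (λ j → Σ< a (λ i → f (suc i) j))))

Σ<-reverse : ∀ n (f : ℕ → ℕ) → Σ< n f ≡ Σ< n (λ i → f (n ∸ suc i))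
Σ<-reverse zero    f = refl
Σ<-reverse (suc n) f = begin
  f 0 + Σ< n (f ∘ suc)                  ≡⟨ cong (f 0 +_) (Σ<-reverse n (f ∘ suc)) ⟩
  f 0 + Σ< n (λ i → f (suc (n ∸ suc i))) ≡⟨ +-comm (f 0) _ ⟩
  Σ< n (λ i → f (suc (n ∸ suc i))) + f 0
    ≡⟨ cong₂ _+_ (Σ<-cong n (λ i i<n → cong f (sym (+-∸-assoc 1 i<n)))) (cong f (sym (n∸n≡0 n))) ⟩
  Σ< n (λ i → f (n ∸ i)) + f (n ∸ n)     ≡⟨ Σ<-snoc n (λ i → f (n ∸ i)) ⟨
  Σ< (suc n) (λ i → f (n ∸ i))           ∎
  where open ≡-Reasoning

Σ∈ : ∀ {a} {A : Set a} → List A → (A → ℕ) → ℕ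
Σ∈ []       f = 0
Σ∈ (x ∷ xs) f = f x + Σ∈ xs f

module _ {a} {A : Set a} where

  Σ∈-mono : ∀ (xs : List A) {f g : A → ℕ} → (∀ x → f x ≤ g x) → Σ∈ xs f ≤ Σ∈ xs g
  Σ∈-mono []       f≤g = z≤n
  Σ∈-mono (x ∷ xs) f≤g = +-mono-≤ (f≤g x) (Σ∈-mono xs f≤g)

  Σ∈-cong : ∀ (xs : List A) {f g : A → ℕ} → (∀ x → f x ≡ g x) → Σ∈ xs f ≡ Σ∈ xs g
  Σ∈-cong []       f≡g = refl
  Σ∈-cong (x ∷ xs) f≡g = cong₂ _+_ (f≡g x) (Σ∈-cong xs f≡g)

  Σ∈-++ : ∀ (xs ys : List A) f → Σ∈ (xs ++ ys) f ≡ Σ∈ xs f + Σ∈ ys f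
  Σ∈-++ []       ys f = refl
  Σ∈-++ (x ∷ xs) ys f = trans (cong (f x +_) (Σ∈-++ xs ys f)) (sym (+-assoc (f x) _ _))

  Σ∈-+ : ∀ (xs : List A) (f g : A → ℕ) → Σ∈ xs (λ x → f x + g x) ≡ Σ∈ xs f + Σ∈ xs g
  Σ∈-+ []       f g = refl
  Σ∈-+ (x ∷ xs) f g = trans (cong ((f x + g x) +_) (Σ∈-+ xs f g)) (interchange (f x) (g x) _ _)

  Σ∈-*ˡ : ∀ (xs : List A) c (f : A → ℕ) → Σ∈ xs (λ x → c * f x) ≡ c * Σ∈ xs f
  Σ∈-*ˡ []       c f = sym (*-zeroʳ c)
  Σ∈-*ˡ (x ∷ xs) c f = trans (cong (c * f x +_) (Σ∈-*ˡ xs c f)) (sym (*-distribˡ-+ c (f x) _))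

  Σ∈-*ʳ : ∀ (xs : List A) c (f : A → ℕ) → Σ∈ xs (λ x → f x * c) ≡ Σ∈ xs f * c
  Σ∈-*ʳ xs c f = trans (Σ∈-cong xs (λ x → *-comm (f x) c)) (trans (Σ∈-*ˡ xs c f) (*-comm c _))

  Σ∈-zero : ∀ (xs : List A) → Σ∈ xs (λ _ → 0) ≡ 0
  Σ∈-zero []       = refl
  Σ∈-zero (x ∷ xs) = Σ∈-zero xs

  Σ∈-concat : ∀ (xss : List (List A)) f → Σ∈ (concat xss) f ≡ Σ∈ xss (λ xs → Σ∈ xs f)
  Σ∈-concat []         f = refl
  Σ∈-concat (xs ∷ xss) f = trans (Σ∈-++ xs (concat xss) f) (cong (Σ∈ xs f +_) (Σ∈-concat xss f))

  Σ∈-applyUpTo : ∀ n (g : ℕ → A) f → Σ∈ (applyUpTo g n) f ≡ Σ< n (f ∘ g)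
  Σ∈-applyUpTo zero    g f = refl
  Σ∈-applyUpTo (suc n) g f = cong (f (g 0) +_) (Σ∈-applyUpTo n (g ∘ suc) f)

Σ∈-map : ∀ {a b} {A : Set a} {B : Set b} (g : A → B) (xs : List A) f → Σ∈ (map g xs) f ≡ Σ∈ xs (f ∘ g)
Σ∈-map g []       f = refl
Σ∈-map g (x ∷ xs) f = cong (f (g x) +_) (Σ∈-map g xs f)

χ : Bool → ℕ
χ true  = 1
χ false = 0

χ≤1 : ∀ b → χ b ≤ 1
χ≤1 true  = s≤s z≤n
χ≤1 false = z≤n

length-filter≡Σ∈χ : ∀ {a} {A : Set a} (p : A → Bool) (xs : List A) →
              length (filter (T? ∘ p) xs) ≡ Σ∈ xs (χ ∘ p)
length-filter≡Σ∈χ p []       = refl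
length-filter≡Σ∈χ p (x ∷ xs) with p x
... | true  = cong suc (length-filter≡Σ∈χ p xs)
... | false = length-filter≡Σ∈χ p xs

-- Sums over the cube [-u,u]^n

D : ℕ → ℕ
D u = suc (2 * u)

φ : ℕ → ℕ → ℤ
φ u i = ℤ.+ i ℤ.- ℤ.+ u

InCube : ℕ → ℕ → List ℤ → Set
InCube u zero    []      = ⊤
InCube u zero    (_ ∷ _) = ⊥
InCube u (suc n) []      = ⊥
InCube u (suc n) (x ∷ v) = (∃[ i ] i < D u × φ u i ≡ x) × InCube u n v

ΣCube : ℕ → ℕ → (List ℤ → ℕ) → ℕ
ΣCube u zero    f = f []
ΣCube u (suc n) f = Σ< (D u) (λ i → ΣCube u n (λ v → f (φ u i ∷ v)))

module _ (u : ℕ) where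

  InCube-length : ∀ n v → InCube u n v → length v ≡ n
  InCube-length zero    []      _       = refl
  InCube-length (suc n) (x ∷ v) (_ , c) = cong suc (InCube-length n v c)

  ΣCube-mono : ∀ n {f g : List ℤ → ℕ} → (∀ v → InCube u n v → f v ≤ g v) → ΣCube u n f ≤ ΣCube u n g
  ΣCube-mono zero    f≤g = f≤g [] tt
  ΣCube-mono (suc n) f≤g =
    Σ<-mono (D u) (λ i i<D → ΣCube-mono n (λ v c → f≤g (φ u i ∷ v) ((i , i<D , refl) , c)))

  ΣCube-cong : ∀ n {f g : List ℤ → ℕ} → (∀ v → InCube u n v → f v ≡ g v) → ΣCube u n f ≡ ΣCube u n g
  ΣCube-cong n f≡g = ≤-antisym (ΣCube-mono n (λ v c → ≤-reflexive (f≡g v c)))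
                               (ΣCube-mono n (λ v c → ≤-reflexive (sym (f≡g v c))))

  ΣCube-+ : ∀ n (f g : List ℤ → ℕ) → ΣCube u n (λ v → f v + g v) ≡ ΣCube u n f + ΣCube u n g
  ΣCube-+ zero    f g = refl
  ΣCube-+ (suc n) f g = trans (Σ<-cong (D u) (λ i _ → ΣCube-+ n (f ∘ (φ u i ∷_)) (g ∘ (φ u i ∷_))))
                              (Σ<-+ (D u) (λ i → ΣCube u n (f ∘ (φ u i ∷_))) (λ i → ΣCube u n (g ∘ (φ u i ∷_))))

  ΣCube-*ˡ : ∀ n c (f : List ℤ → ℕ) → ΣCube u n (λ v → c * f v) ≡ c * ΣCube u n f
  ΣCube-*ˡ zero    c f = refl
  ΣCube-*ˡ (suc n) c f = trans (Σ<-cong (D u) (λ i _ → ΣCube-*ˡ n c (f ∘ (φ u i ∷_))))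
                               (Σ<-*ˡ (D u) c (λ i → ΣCube u n (f ∘ (φ u i ∷_))))

  ΣCube-const : ∀ n c → ΣCube u n (λ _ → c) ≡ D u ^ n * c
  ΣCube-const zero    c = sym (+-identityʳ c)
  ΣCube-const (suc n) c = begin
    Σ< (D u) (λ _ → ΣCube u n (λ _ → c)) ≡⟨ Σ<-cong (D u) (λ i _ → ΣCube-const n c) ⟩
    Σ< (D u) (λ _ → D u ^ n * c)         ≡⟨ Σ<-const (D u) _ ⟩
    D u * (D u ^ n * c)                  ≡⟨ *-assoc (D u) (D u ^ n) c ⟨
    D u ^ suc n * c                      ∎
    where open ≡-Reasoning

  ΣCube-one : ∀ n → ΣCube u n (λ _ → 1) ≡ D u ^ n
  ΣCube-one n = trans (ΣCube-const n 1) (*-identityʳ (D u ^ n))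

  ΣCube-zero : ∀ n → ΣCube u n (λ _ → 0) ≡ 0
  ΣCube-zero n = trans (ΣCube-const n 0) (*-zeroʳ (D u ^ n))

  ΣCube-vanishing : ∀ n {f : List ℤ → ℕ} → (∀ v → InCube u n v → f v ≡ 0) → ΣCube u n f ≡ 0
  ΣCube-vanishing n f≡0 = trans (ΣCube-cong n f≡0) (ΣCube-zero n)

  ΣCube-Σ< : ∀ n M (f : ℕ → List ℤ → ℕ) →
             ΣCube u n (λ v → Σ< M (λ i → f i v)) ≡ Σ< M (λ i → ΣCube u n (f i))
  ΣCube-Σ< zero    M f = refl
  ΣCube-Σ< (suc n) M f = trans (Σ<-cong (D u) (λ j _ → ΣCube-Σ< n M (λ i v → f i (φ u j ∷ v))))
                               (Σ<-comm (D u) M (λ j i → ΣCube u n (λ v → f i (φ u j ∷ v))))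

  ΣCube-Σ∈ : ∀ {a} {A : Set a} n (xs : List A) (f : A → List ℤ → ℕ) →
             ΣCube u n (λ v → Σ∈ xs (λ x → f x v)) ≡ Σ∈ xs (λ x → ΣCube u n (f x))
  ΣCube-Σ∈ n []       f = ΣCube-zero n
  ΣCube-Σ∈ n (x ∷ xs) f = trans (ΣCube-+ n (f x) _) (cong (ΣCube u n (f x) +_) (ΣCube-Σ∈ n xs f))

  ΣCube-++ : ∀ a b (f : List ℤ → ℕ) → ΣCube u (a + b) f ≡ ΣCube u a (λ v → ΣCube u b (λ w → f (v ++ w)))
  ΣCube-++ zero    b f = refl
  ΣCube-++ (suc a) b f = Σ<-cong (D u) (λ i _ → ΣCube-++ a b (f ∘ (φ u i ∷_)))

  Σ∈-samples : ∀ n (f : List ℤ → ℕ) → Σ∈ (samples u n) f ≡ ΣCube u n f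
  Σ∈-samples zero    f = +-identityʳ (f [])
  Σ∈-samples (suc n) f = begin
    Σ∈ (concat (map row (interval u))) f          ≡⟨ Σ∈-concat (map row (interval u)) f ⟩
    Σ∈ (map row (interval u)) (λ xs → Σ∈ xs f)    ≡⟨ Σ∈-map row (interval u) (λ xs → Σ∈ xs f) ⟩
    Σ∈ (map (φ u) (upTo (D u))) (λ x → Σ∈ (row x) f)
      ≡⟨ Σ∈-map (φ u) (upTo (D u)) (λ x → Σ∈ (row x) f) ⟩
    Σ∈ (upTo (D u)) (λ i → Σ∈ (row (φ u i)) f)
      ≡⟨ Σ∈-applyUpTo (D u) (λ i → i) (λ i → Σ∈ (row (φ u i)) f) ⟩
    Σ< (D u) (λ i → Σ∈ (row (φ u i)) f)
      ≡⟨ Σ<-cong (D u) (λ i _ → trans (Σ∈-map (φ u i ∷_) (samples u n) f) (Σ∈-samples n (f ∘ (φ u i ∷_)))) ⟩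
    ΣCube u (suc n) f                             ∎
    where
    open ≡-Reasoning
    row : ℤ → List (List ℤ)
    row x = map (x ∷_) (samples u n)

  countE≡ΣCube : ∀ m k → countE u m k ≡ ΣCube u m (χ ∘ E k)
  countE≡ΣCube m k = trans (length-filter≡Σ∈χ (E k) (samples u m)) (Σ∈-samples m (χ ∘ E k))

-- Zero-sum subsets and the event E_k

isZeroSum : ℕ → List ℤ → Bool
isZeroSum k s = (length s ≡ᵇ k) ∧ does (sumℤ s ℤ.≟ ℤ.+ 0)

[]∈subselections : ∀ v → [] ∈ subselections v
[]∈subselections []      = here refl
[]∈subselections (x ∷ v) = ∈-++⁺ʳ (map (x ∷_) (subselections v)) ([]∈subselections v)

subselections-++ˡ : ∀ v w → subselections v ⊆ subselections (v ++ w)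
subselections-++ˡ []      w (here refl) = []∈subselections w
subselections-++ˡ []      w (there ())
subselections-++ˡ (x ∷ v) w = ++⁺ (map⁺ (x ∷_) (subselections-++ˡ v w)) (subselections-++ˡ v w)

subselections-++ʳ : ∀ v w → subselections w ⊆ subselections (v ++ w)
subselections-++ʳ []      w = ⊆-refl
subselections-++ʳ (x ∷ v) w =
  ⊆-trans (subselections-++ʳ v w) (xs⊆ys++xs (subselections (v ++ w)) (map (x ∷_) (subselections (v ++ w))))

E-mono : ∀ k v w → subselections v ⊆ subselections w → T (E k v) → T (E k w)
E-mono k v w v⊆w = any⁺ (isZeroSum k) ∘ Any-resp-⊆ v⊆w ∘ any⁻ (isZeroSum k) (subselections v)

χ-not≤* : ∀ a b {c} → (T a → T c) → (T b → T c) → χ (not c) ≤ χ (not a) * χ (not b)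
χ-not≤* _     _     {true}  _   _   = z≤n
χ-not≤* true  _     {false} a⇒c _   = ⊥-elim (a⇒c tt)
χ-not≤* false true  {false} _   b⇒c = ⊥-elim (b⇒c tt)
χ-not≤* false false {false} _   _   = ≤-refl

χ¬E-++ : ∀ k v w → χ (not (E k (v ++ w))) ≤ χ (not (E k v)) * χ (not (E k w))
χ¬E-++ k v w = χ-not≤* (E k v) (E k w) (E-mono k v (v ++ w) (subselections-++ˡ v w)) (E-mono k w (v ++ w) (subselections-++ʳ v w))

module _ {a} {A : Set a} (p : A → Bool) where

  χ-any≤Σ∈ : ∀ xs → χ (any p xs) ≤ Σ∈ xs (χ ∘ p)
  χ-any≤Σ∈ []       = z≤n
  χ-any≤Σ∈ (x ∷ xs) with p x
  ... | true  = s≤s z≤n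
  ... | false = χ-any≤Σ∈ xs

  ¬any⇒Σ∈χ≡0 : ∀ xs → any p xs ≡ false → Σ∈ xs (χ ∘ p) ≡ 0
  ¬any⇒Σ∈χ≡0 []       _ = refl
  ¬any⇒Σ∈χ≡0 (x ∷ xs) e with p x
  ... | false = ¬any⇒Σ∈χ≡0 xs e

select : List Bool → List ℤ → List ℤ
select []          _       = []
select (_ ∷ _)     []      = []
select (true  ∷ b) (x ∷ v) = x ∷ select b v
select (false ∷ b) (x ∷ v) = select b v

masks : ℕ → List (List Bool)
masks zero    = [] ∷ []
masks (suc n) = map (true ∷_) (masks n) ++ map (false ∷_) (masks n)

subselections≡select-masks : ∀ v → subselections v ≡ map (λ b → select b v) (masks (length v))
subselections≡select-masks []      = refl
subselections≡select-masks (x ∷ v) = begin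
  map (x ∷_) (subselections v) ++ subselections v
    ≡⟨ cong (λ L → map (x ∷_) L ++ L) (subselections≡select-masks v) ⟩
  map (x ∷_) (map (λ b → select b v) M) ++ map (λ b → select b v) M
    ≡⟨ cong (_++ map (λ b → select b v) M) (map-∘ M) ⟨
  map (λ b → select (true ∷ b) (x ∷ v)) M ++ map (λ b → select (false ∷ b) (x ∷ v)) M
    ≡⟨ cong₂ _++_ (map-∘ M) (map-∘ M) ⟩
  map (λ b → select b (x ∷ v)) (map (true ∷_) M) ++ map (λ b → select b (x ∷ v)) (map (false ∷_) M)
    ≡⟨ map-++ (λ b → select b (x ∷ v)) (map (true ∷_) M) (map (false ∷_) M) ⟨
  map (λ b → select b (x ∷ v)) (masks (length (x ∷ v))) ∎
  where
  open ≡-Reasoning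
  M = masks (length v)

E≡any-select : ∀ k v → E k v ≡ any (isZeroSum k) (map (λ b → select b v) (masks (length v)))
E≡any-select k v = cong (any (isZeroSum k)) (subselections≡select-masks v)

ones : List Bool → ℕ
ones []          = 0
ones (true  ∷ b) = suc (ones b)
ones (false ∷ b) = ones b

zeros : List Bool → ℕ
zeros []          = 0
zeros (true  ∷ b) = zeros b
zeros (false ∷ b) = suc (zeros b)

zeros+ones≡length : ∀ b → zeros b + ones b ≡ length b
zeros+ones≡length []          = refl
zeros+ones≡length (true  ∷ b) = trans (+-suc (zeros b) (ones b)) (cong suc (zeros+ones≡length b))
zeros+ones≡length (false ∷ b) = cong suc (zeros+ones≡length b)

Σ∈-masks-suc : ∀ n (F : List Bool → ℕ) →
               Σ∈ (masks (suc n)) F ≡ Σ∈ (masks n) (F ∘ (true ∷_)) + Σ∈ (masks n) (F ∘ (false ∷_))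
Σ∈-masks-suc n F = trans (Σ∈-++ (map (true ∷_) (masks n)) (map (false ∷_) (masks n)) F)
                         (cong₂ _+_ (Σ∈-map (true ∷_) (masks n) F) (Σ∈-map (false ∷_) (masks n) F))

Σ∈-masks-mono : ∀ n {F G : List Bool → ℕ} → (∀ b → length b ≡ n → F b ≤ G b) →
                Σ∈ (masks n) F ≤ Σ∈ (masks n) G
Σ∈-masks-mono zero    F≤G = +-monoˡ-≤ 0 (F≤G [] refl)
Σ∈-masks-mono (suc n) {F} {G} F≤G = begin
  Σ∈ (masks (suc n)) F                                    ≡⟨ Σ∈-masks-suc n F ⟩
  Σ∈ (masks n) (F ∘ (true ∷_)) + Σ∈ (masks n) (F ∘ (false ∷_))
    ≤⟨ +-mono-≤ (Σ∈-masks-mono n (λ b e → F≤G (true ∷ b) (cong suc e)))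
                (Σ∈-masks-mono n (λ b e → F≤G (false ∷ b) (cong suc e))) ⟩
  Σ∈ (masks n) (G ∘ (true ∷_)) + Σ∈ (masks n) (G ∘ (false ∷_)) ≡⟨ Σ∈-masks-suc n G ⟨
  Σ∈ (masks (suc n)) G                                    ∎
  where open ≤-Reasoning

Σ∈-masks-cong : ∀ n {F G : List Bool → ℕ} → (∀ b → length b ≡ n → F b ≡ G b) →
                Σ∈ (masks n) F ≡ Σ∈ (masks n) G
Σ∈-masks-cong n F≡G = ≤-antisym (Σ∈-masks-mono n (λ b l → ≤-reflexive (F≡G b l)))
                                (Σ∈-masks-mono n (λ b l → ≤-reflexive (sym (F≡G b l))))

Σ∈-masks-ones : ∀ n k → Σ∈ (masks n) (λ b → χ (ones b ≡ᵇ k)) ≡ n C k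
Σ∈-masks-ones zero    zero    = refl
Σ∈-masks-ones zero    (suc k) = refl
Σ∈-masks-ones (suc n) zero    =
  trans (Σ∈-masks-suc n _) (cong₂ _+_ (Σ∈-zero (masks n)) (Σ∈-masks-ones n zero))
Σ∈-masks-ones (suc n) (suc k) =
  trans (Σ∈-masks-suc n _) (trans (cong₂ _+_ (Σ∈-masks-ones n k) (Σ∈-masks-ones n (suc k)))
                                  (nCk+nC[k+1]≡[n+1]C[k+1] n k))

_≟ᴮ_ : (b b′ : List Bool) → Dec (b ≡ b′)
_≟ᴮ_ = ≡-dec Bool._≟_

Σ∈-masks-≡ : ∀ n b → Σ∈ (masks n) (λ b′ → χ (does (b′ ≟ᴮ b))) ≤ 1
Σ∈-masks-≡ zero    b = subst (_≤ 1) (sym (+-identityʳ _)) (χ≤1 (does ([] ≟ᴮ b)))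
Σ∈-masks-≡ (suc n) b = begin
  Σ∈ (masks (suc n)) (≡b b)                                  ≡⟨ Σ∈-masks-suc n (≡b b) ⟩
  Σ∈ (masks n) (≡b b ∘ (true ∷_)) + Σ∈ (masks n) (≡b b ∘ (false ∷_)) ≤⟨ split b ⟩
  1                                                          ∎
  where
  open ≤-Reasoning
  ≡b : List Bool → List Bool → ℕ
  ≡b b b′ = χ (does (b′ ≟ᴮ b))
  split : ∀ b → Σ∈ (masks n) (≡b b ∘ (true ∷_)) + Σ∈ (masks n) (≡b b ∘ (false ∷_)) ≤ 1
  split []          = ≤-trans (≤-reflexive (cong₂ _+_ (Σ∈-zero (masks n)) (Σ∈-zero (masks n)))) z≤n
  split (true  ∷ b) = subst (_≤ 1) (sym (trans (cong (Σ∈ (masks n) (≡b b) +_) (Σ∈-zero (masks n))) (+-identityʳ _)))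
                            (Σ∈-masks-≡ n b)
  split (false ∷ b) = subst (_≤ 1) (sym (cong (_+ Σ∈ (masks n) (≡b b)) (Σ∈-zero (masks n)))) (Σ∈-masks-≡ n b)

infix 4 _⊄_
data _⊄_ : List Bool → List Bool → Set where
  here  : ∀ {b′ b} → true ∷ b′ ⊄ false ∷ b
  there : ∀ {x y b′ b} → b′ ⊄ b → x ∷ b′ ⊄ y ∷ b

⊄-from-ones : ∀ b b′ → length b ≡ length b′ → ones b ≤ ones b′ → b′ ≢ b → b′ ⊄ b
⊄-from-ones []          []           _ _ b′≢b = contradiction refl b′≢b
⊄-from-ones (false ∷ b) (true  ∷ b′) _ _ _    = here
⊄-from-ones (true  ∷ b) (true  ∷ b′) l (s≤s o) b′≢b =
  there (⊄-from-ones b b′ (suc-injective l) o (b′≢b ∘ cong (true ∷_)))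
⊄-from-ones (false ∷ b) (false ∷ b′) l o b′≢b =
  there (⊄-from-ones b b′ (suc-injective l) o (b′≢b ∘ cong (false ∷_)))
⊄-from-ones (true  ∷ b) (false ∷ b′) l o _    =
  there (⊄-from-ones b b′ (suc-injective l) (≤-trans (n≤1+n _) o) (λ b′≡b → <-irrefl (cong ones (sym b′≡b)) o))

module _ (u : ℕ) where

  ΣCube-select : ∀ b (h : List ℤ → ℕ) →
                 ΣCube u (length b) (λ v → h (select b v)) ≡ D u ^ zeros b * ΣCube u (ones b) h
  ΣCube-select []          h = sym (+-identityʳ (h []))
  ΣCube-select (true ∷ b)  h = begin
    Σ< (D u) (λ i → ΣCube u (length b) (λ v → h (φ u i ∷ select b v)))
      ≡⟨ Σ<-cong (D u) (λ i _ → ΣCube-select b (h ∘ (φ u i ∷_))) ⟩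
    Σ< (D u) (λ i → D u ^ zeros b * ΣCube u (ones b) (h ∘ (φ u i ∷_)))
      ≡⟨ Σ<-*ˡ (D u) (D u ^ zeros b) (λ i → ΣCube u (ones b) (h ∘ (φ u i ∷_))) ⟩
    D u ^ zeros b * ΣCube u (suc (ones b)) h ∎
    where open ≡-Reasoning
  ΣCube-select (false ∷ b) h = begin
    Σ< (D u) (λ _ → ΣCube u (length b) (λ v → h (select b v)))
      ≡⟨ Σ<-cong (D u) (λ _ _ → ΣCube-select b h) ⟩
    Σ< (D u) (λ _ → D u ^ zeros b * ΣCube u (ones b) h)
      ≡⟨ Σ<-const (D u) _ ⟩
    D u * (D u ^ zeros b * ΣCube u (ones b) h)
      ≡⟨ *-assoc (D u) (D u ^ zeros b) _ ⟨
    D u ^ suc (zeros b) * ΣCube u (ones b) h ∎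
    where open ≡-Reasoning

-- Anti-concentration

δ : ℤ → ℤ → ℕ
δ a c = χ (does (a ℤ.≟ c))

δ-cong : ∀ {a c a′ c′} → (a ≡ c → a′ ≡ c′) → (a′ ≡ c′ → a ≡ c) → δ a c ≡ δ a′ c′
δ-cong {a} {c} {a′} {c′} ⇒ ⇐ with a ℤ.≟ c | a′ ℤ.≟ c′
... | yes _  | yes _  = refl
... | no  _  | no  _  = refl
... | yes p  | no ¬q  = contradiction (⇒ p) ¬q
... | no ¬p  | yes q  = contradiction (⇐ q) ¬p

δ-refl : ∀ {a c} → a ≡ c → δ a c ≡ 1
δ-refl {a} {c} a≡c with a ℤ.≟ c
... | yes _   = refl
... | no  a≢c = contradiction a≡c a≢c

δ-shift : ∀ a t c → δ (a ℤ.+ t) c ≡ δ t (c ℤ.- a)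
δ-shift a t c = δ-cong (λ e → trans (t≡a+t-a a t) (cong (ℤ._- a) e))
                       (λ e → trans (cong (λ z → a ℤ.+ z) e) (a+[c-a]≡c a c))
  where
  t≡a+t-a : ∀ a t → t ≡ (a ℤ.+ t) ℤ.- a
  t≡a+t-a = ℤ-solve-∀
  a+[c-a]≡c : ∀ a c → a ℤ.+ (c ℤ.- a) ≡ c
  a+[c-a]≡c = ℤ-solve-∀

Σ<-δ≤1 : ∀ n (g : ℕ → ℤ) → (∀ {i j} → g i ≡ g j → i ≡ j) → ∀ c → Σ< n (λ i → δ (g i) c) ≤ 1
Σ<-δ≤1 zero    g g-inj c = z≤n
Σ<-δ≤1 (suc n) g g-inj c with g 0 ℤ.≟ c
... | no  _    = Σ<-δ≤1 n (g ∘ suc) (suc-injective ∘ g-inj) c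
... | yes g0≡c = s≤s (≤-reflexive (trans (Σ<-cong n (λ i _ → missed i)) (trans (Σ<-const n 0) (*-zeroʳ n))))
  where
  missed : ∀ i → δ (g (suc i)) c ≡ 0
  missed i with g (suc i) ℤ.≟ c
  ... | yes gi≡c = contradiction (g-inj (trans gi≡c (sym g0≡c))) λ ()
  ... | no  _    = refl

φ+-injective : ∀ u t {i j} → φ u i ℤ.+ t ≡ φ u j ℤ.+ t → i ≡ j
φ+-injective u t {i} {j} e = ℤP.+-injective (begin
  ℤ.+ i                                   ≡⟨ recover (ℤ.+ i) ⟩
  φ u i ℤ.+ t ℤ.- t ℤ.+ ℤ.+ u             ≡⟨ cong (λ z → z ℤ.- t ℤ.+ ℤ.+ u) e ⟩
  φ u j ℤ.+ t ℤ.- t ℤ.+ ℤ.+ u             ≡⟨ recover (ℤ.+ j) ⟨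
  ℤ.+ j                                   ∎)
  where
  open ≡-Reasoning
  recover′ : ∀ x w t → x ≡ x ℤ.- w ℤ.+ t ℤ.- t ℤ.+ w
  recover′ = ℤ-solve-∀
  recover : ∀ x → x ≡ x ℤ.- ℤ.+ u ℤ.+ t ℤ.- t ℤ.+ ℤ.+ u
  recover x = recover′ x (ℤ.+ u) t

Σ<-δ-interval≤1 : ∀ u t c → Σ< (D u) (λ i → δ (φ u i ℤ.+ t) c) ≤ 1
Σ<-δ-interval≤1 u t = Σ<-δ≤1 (D u) (λ i → φ u i ℤ.+ t) (φ+-injective u t)

consIf : Bool → ℤ → List ℤ → List ℤ
consIf true  a s = a ∷ s
consIf false a s = s

subIf : Bool → ℤ → ℤ → ℤ
subIf true  a c = c ℤ.- a
subIf false a c = c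

select-∷ : ∀ x a b v → select (x ∷ b) (a ∷ v) ≡ consIf x a (select b v)
select-∷ true  a b v = refl
select-∷ false a b v = refl

δ-sum-consIf : ∀ y a s c → δ (sumℤ (consIf y a s)) c ≡ δ (sumℤ s) (subIf y a c)
δ-sum-consIf true  a s c = δ-shift a (sumℤ s) c
δ-sum-consIf false a s c = refl

module _ (u : ℕ) where

  -- Fix every coordinate except one that b′ selects and b does not: at most one value of
  -- that coordinate puts the sum of the b′-entries at c.
  ΣCube-⊄ : ∀ b b′ → b′ ⊄ b → ∀ (h : List ℤ → ℕ) c →
            D u * ΣCube u (length b) (λ v → h (select b v) * δ (sumℤ (select b′ v)) c)
              ≤ ΣCube u (length b) (λ v → h (select b v))
  ΣCube-⊄ (false ∷ b) (true ∷ b′) here h c = begin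
    D u * Σ< (D u) (λ i → ΣCube u n (λ v → hb v * δ (φ u i ℤ.+ s′ v) c))
      ≡⟨ cong (D u *_) (ΣCube-Σ< u n (D u) (λ i v → hb v * δ (φ u i ℤ.+ s′ v) c)) ⟨
    D u * ΣCube u n (λ v → Σ< (D u) (λ i → hb v * δ (φ u i ℤ.+ s′ v) c))
      ≡⟨ cong (D u *_) (ΣCube-cong u n (λ v _ → Σ<-*ˡ (D u) (hb v) (λ i → δ (φ u i ℤ.+ s′ v) c))) ⟩
    D u * ΣCube u n (λ v → hb v * Σ< (D u) (λ i → δ (φ u i ℤ.+ s′ v) c))
      ≤⟨ *-monoʳ-≤ (D u) (ΣCube-mono u n (λ v _ → *-monoʳ-≤ (hb v) (Σ<-δ-interval≤1 u (s′ v) c))) ⟩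
    D u * ΣCube u n (λ v → hb v * 1)
      ≡⟨ cong (D u *_) (ΣCube-cong u n (λ v _ → *-identityʳ (hb v))) ⟩
    D u * ΣCube u n hb
      ≡⟨ Σ<-const (D u) (ΣCube u n hb) ⟨
    Σ< (D u) (λ _ → ΣCube u n hb) ∎
    where
    open ≤-Reasoning
    n = length b
    hb : List ℤ → ℕ
    hb v = h (select b v)
    s′ : List ℤ → ℤ
    s′ v = sumℤ (select b′ v)
  ΣCube-⊄ (x ∷ b) (y ∷ b′) (there b′⊄b) h c = begin
    D u * Σ< (D u) (λ i → ΣCube u n (term i))       ≡⟨ Σ<-*ˡ (D u) (D u) (λ i → ΣCube u n (term i)) ⟨
    Σ< (D u) (λ i → D u * ΣCube u n (term i))
      ≡⟨ Σ<-cong (D u) (λ i _ → cong (D u *_) (ΣCube-cong u n (λ v _ → term-tail i v))) ⟩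
    Σ< (D u) (λ i → D u * ΣCube u n (λ v → h (consIf x (φ u i) (select b v)) * δ (sumℤ (select b′ v)) (subIf y (φ u i) c)))
      ≤⟨ Σ<-mono (D u) (λ i _ → ΣCube-⊄ b b′ b′⊄b (h ∘ consIf x (φ u i)) (subIf y (φ u i) c)) ⟩
    Σ< (D u) (λ i → ΣCube u n (λ v → h (consIf x (φ u i) (select b v))))
      ≡⟨ Σ<-cong (D u) (λ i _ → ΣCube-cong u n (λ v _ → cong h (select-∷ x (φ u i) b v))) ⟨
    Σ< (D u) (λ i → ΣCube u n (λ v → h (select (x ∷ b) (φ u i ∷ v)))) ∎
    where
    open ≤-Reasoning
    n = length b
    term : ℕ → List ℤ → ℕ
    term i v = h (select (x ∷ b) (φ u i ∷ v)) * δ (sumℤ (select (y ∷ b′) (φ u i ∷ v))) c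
    term-tail : ∀ i v → term i v ≡ h (consIf x (φ u i) (select b v)) * δ (sumℤ (select b′ v)) (subIf y (φ u i) c)
    term-tail i v = cong₂ _*_ (cong h (select-∷ x (φ u i) b v))
                              (trans (cong (λ s → δ (sumℤ s) c) (select-∷ y (φ u i) b′ v))
                                     (δ-sum-consIf y (φ u i) (select b′ v) c))

-- The distribution of a sum of uniform entries

antitone-by-steps : ∀ (f : ℕ → ℕ) → (∀ n → f (suc n) ≤ f n) → ∀ {m n} → m ≤ n → f n ≤ f m
antitone-by-steps f step = go ∘ ≤⇒≤′
  where
  go : ∀ {m n} → m ≤′ n → f n ≤ f m
  go ≤′-refl        = ≤-refl
  go (≤′-step m≤′n) = ≤-trans (step _) (go m≤′n)

pos-∸ : ∀ {m i} → i ≤ m → ℤ.+ (m ∸ i) ≡ ℤ.+ m ℤ.- ℤ.+ i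
pos-∸ {m} {i} i≤m = sym (trans (ℤP.m-n≡m⊖n m i) (ℤP.⊖-≥ i≤m))

ways : ℕ → ℕ → ℤ → ℕ
ways u j s = ΣCube u j (λ v → δ (sumℤ v) s)

module _ (u : ℕ) where

  ways-suc : ∀ j s → ways u (suc j) s ≡ Σ< (D u) (λ i → ways u j (s ℤ.- φ u i))
  ways-suc j s = Σ<-cong (D u) (λ i _ → ΣCube-cong u j (λ v _ → δ-shift (φ u i) (sumℤ v) s))

  pos-2u : ℤ.+ (2 * u) ≡ ℤ.+ u ℤ.+ ℤ.+ u
  pos-2u = trans (cong ℤ.+_ (cong (u +_) (+-identityʳ u))) (ℤP.pos-+ u u)

  φ-reverse : ∀ {i} → i < D u → φ u (D u ∸ suc i) ≡ ℤ.- φ u i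
  φ-reverse {i} (s≤s i≤2u) = begin
    ℤ.+ (2 * u ∸ i) ℤ.- ℤ.+ u        ≡⟨ cong (ℤ._- ℤ.+ u) (pos-∸ i≤2u) ⟩
    ℤ.+ (2 * u) ℤ.- ℤ.+ i ℤ.- ℤ.+ u  ≡⟨ cong (λ z → z ℤ.- ℤ.+ i ℤ.- ℤ.+ u) pos-2u ⟩
    ℤ.+ u ℤ.+ ℤ.+ u ℤ.- ℤ.+ i ℤ.- ℤ.+ u ≡⟨ reflect (ℤ.+ u) (ℤ.+ i) ⟩
    ℤ.- φ u i                         ∎
    where
    open ≡-Reasoning
    reflect : ∀ w x → w ℤ.+ w ℤ.- x ℤ.- w ≡ ℤ.- (x ℤ.- w)
    reflect = ℤ-solve-∀

  ways-neg : ∀ j s → ways u j (ℤ.- s) ≡ ways u j s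
  ways-neg zero    s = δ-cong {ℤ.+ 0} {ℤ.- s} {ℤ.+ 0} {s}
    (λ 0≡-s → trans (cong (λ z → ℤ.- z) 0≡-s) (ℤP.neg-involutive s)) (cong (λ z → ℤ.- z))
  ways-neg (suc j) s = begin
    ways u (suc j) (ℤ.- s)                          ≡⟨ ways-suc j (ℤ.- s) ⟩
    Σ< (D u) (λ i → ways u j (ℤ.- s ℤ.- φ u i))
      ≡⟨ Σ<-cong (D u) (λ i _ → trans (cong (ways u j) (neg-+ s (φ u i))) (ways-neg j _)) ⟩
    Σ< (D u) (λ i → ways u j (s ℤ.+ φ u i))         ≡⟨ Σ<-cong (D u) (λ i i<D →
         trans (cong (λ z → ways u j (s ℤ.- z)) (φ-reverse i<D)) (cong (ways u j) (minus-neg s (φ u i)))) ⟨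
    Σ< (D u) (λ i → ways u j (s ℤ.- φ u (D u ∸ suc i))) ≡⟨ Σ<-reverse (D u) (λ i → ways u j (s ℤ.- φ u i)) ⟨
    Σ< (D u) (λ i → ways u j (s ℤ.- φ u i))         ≡⟨ ways-suc j s ⟨
    ways u (suc j) s                                ∎
    where
    open ≡-Reasoning
    neg-+ : ∀ s x → ℤ.- s ℤ.- x ≡ ℤ.- (s ℤ.+ x)
    neg-+ = ℤ-solve-∀
    minus-neg : ∀ s x → s ℤ.- ℤ.- x ≡ s ℤ.+ x
    minus-neg = ℤ-solve-∀

  ways-abs : ∀ j s → ways u j s ≡ ways u j (ℤ.+ ∣ s ∣)
  ways-abs j (ℤ.+ n)    = refl
  ways-abs j ℤ.-[1+ n ] = ways-neg j (ℤ.+ suc n)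

  Unimodal : ℕ → Set
  Unimodal j = ∀ s t → ∣ s ∣ ≤ ∣ t ∣ → ways u j t ≤ ways u j s

  -- Raising the target from a to a+1 slides the convolution window: the term at argument a-u
  -- leaves and the term at argument a+1+u enters, which is no larger by unimodality.
  ways-suc-step : ∀ j → Unimodal j → ∀ a → ways u (suc j) (ℤ.+ suc a) ≤ ways u (suc j) (ℤ.+ a)
  ways-suc-step j unimodal a = +-cancelʳ-≤ (f (D u)) _ _ (begin
    ways u (suc j) (ℤ.+ suc a) + f (D u) ≡⟨ cong (_+ f (D u)) (ways-suc j (ℤ.+ suc a)) ⟩
    Σ< (D u) f + f (D u)                 ≡⟨ Σ<-snoc (D u) f ⟨
    f 0 + Σ< (D u) (f ∘ suc)
      ≡⟨ cong (f 0 +_) (Σ<-cong (D u) (λ i _ → cong (ways u j) (shift (ℤ.+ a) (ℤ.+ i) (ℤ.+ u)))) ⟩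
    f 0 + Σ< (D u) (λ i → ways u j (ℤ.+ a ℤ.- φ u i))
                                         ≡⟨ cong (f 0 +_) (ways-suc j (ℤ.+ a)) ⟨
    f 0 + ways u (suc j) (ℤ.+ a)         ≤⟨ +-monoˡ-≤ _ (unimodal _ _ ∣last∣≤∣first∣) ⟩
    f (D u) + ways u (suc j) (ℤ.+ a)     ≡⟨ +-comm (f (D u)) _ ⟩
    ways u (suc j) (ℤ.+ a) + f (D u)     ∎)
    where
    open ≤-Reasoning
    f : ℕ → ℕ
    f i = ways u j (ℤ.+ suc a ℤ.- φ u i)
    shift : ∀ a i u → ℤ.+ 1 ℤ.+ a ℤ.- (ℤ.+ 1 ℤ.+ i ℤ.- u) ≡ a ℤ.- (i ℤ.- u)
    shift = ℤ-solve-∀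
    first : ℤ.+ suc a ℤ.- φ u 0 ≡ ℤ.+ (suc a + u)
    first = trans (l (ℤ.+ suc a) (ℤ.+ u)) (sym (ℤP.pos-+ (suc a) u))
      where
      l : ∀ a u → a ℤ.- (ℤ.+ 0 ℤ.- u) ≡ a ℤ.+ u
      l = ℤ-solve-∀
    last : ℤ.+ suc a ℤ.- φ u (D u) ≡ ℤ.+ a ℤ.- ℤ.+ u
    last = trans (cong (λ z → ℤ.+ suc a ℤ.- (ℤ.+ 1 ℤ.+ z ℤ.- ℤ.+ u)) pos-2u) (l (ℤ.+ a) (ℤ.+ u))
      where
      l : ∀ a u → ℤ.+ 1 ℤ.+ a ℤ.- (ℤ.+ 1 ℤ.+ (u ℤ.+ u) ℤ.- u) ≡ a ℤ.- u
      l = ℤ-solve-∀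
    ∣last∣≤∣first∣ : ∣ ℤ.+ suc a ℤ.- φ u (D u) ∣ ≤ ∣ ℤ.+ suc a ℤ.- φ u 0 ∣
    ∣last∣≤∣first∣ = subst₂ (λ x y → ∣ x ∣ ≤ ∣ y ∣) (sym last) (sym first)
                           (≤-trans (ℤP.∣i-j∣≤∣i∣+∣j∣ (ℤ.+ a) (ℤ.+ u)) (n≤1+n (a + u)))

  unimodal : ∀ j → Unimodal j
  unimodal zero    s t ∣s∣≤∣t∣ with ℤ.+ 0 ℤ.≟ t
  ... | no  _    = z≤n
  ... | yes refl with ℤP.∣i∣≡0⇒i≡0 {s} (n≤0⇒n≡0 ∣s∣≤∣t∣)
  ... | refl     = ≤-refl
  unimodal (suc j) s t ∣s∣≤∣t∣ = begin
    ways u (suc j) t             ≡⟨ ways-abs (suc j) t ⟩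
    ways u (suc j) (ℤ.+ ∣ t ∣)
      ≤⟨ antitone-by-steps (ways u (suc j) ∘ ℤ.+_) (ways-suc-step j (unimodal j)) ∣s∣≤∣t∣ ⟩
    ways u (suc j) (ℤ.+ ∣ s ∣)   ≡⟨ ways-abs (suc j) s ⟨
    ways u (suc j) s             ∎
    where open ≤-Reasoning

  InCube-sum : ∀ j v → InCube u j v → ∃[ a ] a ≤ 2 * (j * u) × sumℤ v ≡ ℤ.+ a ℤ.- ℤ.+ (j * u)
  InCube-sum zero    []      _ = 0 , z≤n , refl
  InCube-sum (suc j) (x ∷ v) ((i , s≤s i≤2u , refl) , c) with InCube-sum j v c
  ... | a , a≤ , sum≡ = i + a , bound , sum-eq
    where
    bound : i + a ≤ 2 * (suc j * u)
    bound = ≤-trans (+-mono-≤ i≤2u a≤) (≤-reflexive (sym (*-distribˡ-+ 2 u (j * u))))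
    regroup : ∀ i a u w → (i ℤ.- u) ℤ.+ (a ℤ.- w) ≡ (i ℤ.+ a) ℤ.- (u ℤ.+ w)
    regroup = ℤ-solve-∀
    sum-eq : φ u i ℤ.+ sumℤ v ≡ ℤ.+ (i + a) ℤ.- ℤ.+ (u + j * u)
    sum-eq = begin
      φ u i ℤ.+ sumℤ v                                 ≡⟨ cong (λ z → φ u i ℤ.+ z) sum≡ ⟩
      φ u i ℤ.+ (ℤ.+ a ℤ.- ℤ.+ (j * u))                ≡⟨ regroup (ℤ.+ i) (ℤ.+ a) (ℤ.+ u) (ℤ.+ (j * u)) ⟩
      (ℤ.+ i ℤ.+ ℤ.+ a) ℤ.- (ℤ.+ u ℤ.+ ℤ.+ (j * u))    ≡⟨ cong₂ ℤ._-_ (ℤP.pos-+ i a) (ℤP.pos-+ u (j * u)) ⟨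
      ℤ.+ (i + a) ℤ.- ℤ.+ (u + j * u)                  ∎
      where open ≡-Reasoning

  -- A sum over [-u,u]^j takes 2ju+1 values, none more likely than 0.
  D^j≤[2ju+1]*ways-zero : ∀ j → D u ^ j ≤ suc (2 * (j * u)) * ways u j (ℤ.+ 0)
  D^j≤[2ju+1]*ways-zero j = begin
    D u ^ j                                         ≡⟨ ΣCube-one u j ⟨
    ΣCube u j (λ _ → 1)                             ≤⟨ ΣCube-mono u j (λ v c → hit v c) ⟩
    ΣCube u j (λ v → Σ< M (λ a → δ (sumℤ v) (s a))) ≡⟨ ΣCube-Σ< u j M (λ a v → δ (sumℤ v) (s a)) ⟩
    Σ< M (λ a → ways u j (s a))                     ≤⟨ Σ<-mono M (λ a _ → unimodal j (ℤ.+ 0) (s a) z≤n) ⟩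
    Σ< M (λ _ → ways u j (ℤ.+ 0))                   ≡⟨ Σ<-const M _ ⟩
    M * ways u j (ℤ.+ 0)                            ∎
    where
    open ≤-Reasoning
    M = suc (2 * (j * u))
    s : ℕ → ℤ
    s a = ℤ.+ a ℤ.- ℤ.+ (j * u)
    hit : ∀ v → InCube u j v → 1 ≤ Σ< M (λ a → δ (sumℤ v) (s a))
    hit v c with InCube-sum j v c
    ... | a , a≤ , sum≡ = ≤-trans (≤-reflexive (sym (δ-refl sum≡))) (≤Σ< M (λ a → δ (sumℤ v) (s a)) (s≤s a≤))

  ways-suc≤ : ∀ j s → ways u (suc j) s ≤ D u ^ j
  ways-suc≤ j s = begin
    Σ< (D u) (λ i → ΣCube u j (λ v → δ (φ u i ℤ.+ sumℤ v) s))
      ≡⟨ ΣCube-Σ< u j (D u) (λ i v → δ (φ u i ℤ.+ sumℤ v) s) ⟨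
    ΣCube u j (λ v → Σ< (D u) (λ i → δ (φ u i ℤ.+ sumℤ v) s))
      ≤⟨ ΣCube-mono u j (λ v _ → Σ<-δ-interval≤1 u (sumℤ v) s) ⟩
    ΣCube u j (λ _ → 1)                                         ≡⟨ ΣCube-one u j ⟩
    D u ^ j                                                     ∎
    where open ≤-Reasoning

-- One block: first and second moments

≡ᵇ-true⇒≡ : ∀ {m n} → (m ≡ᵇ n) ≡ true → m ≡ n
≡ᵇ-true⇒≡ {m} {n} e = ≡ᵇ⇒≡ m n (subst T (sym e) tt)

≡ᵇ-false⇒≢ : ∀ {m n} → (m ≡ᵇ n) ≡ false → m ≢ n
≡ᵇ-false⇒≢ {m} {n} e m≡n = subst T e (≡⇒≡ᵇ m n m≡n)

isZeroSum-length : ∀ k s → length s ≢ k → χ (isZeroSum k s) ≡ 0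
isZeroSum-length k s ≢k with length s ≡ᵇ k in e
... | false = refl
... | true  = contradiction (≡ᵇ-true⇒≡ e) ≢k

isZeroSum-δ : ∀ k s → length s ≡ k → χ (isZeroSum k s) ≡ δ (sumℤ s) (ℤ.+ 0)
isZeroSum-δ k s refl with length s ≡ᵇ length s in e
... | true  = refl
... | false = contradiction refl (≡ᵇ-false⇒≢ {length s} e)

isZeroSum≤δ : ∀ k s → χ (isZeroSum k s) ≤ δ (sumℤ s) (ℤ.+ 0)
isZeroSum≤δ k s with length s ≡ᵇ k
... | true  = ≤-refl
... | false = z≤n

length-select : ∀ b v → length v ≡ length b → length (select b v) ≡ ones b
length-select []          v       _ = refl
length-select (true  ∷ b) (x ∷ v) e = cong suc (length-select b v (suc-injective e))
length-select (false ∷ b) (x ∷ v) e = length-select b v (suc-injective e)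

zeroSumAt : ℕ → List Bool → List ℤ → ℕ
zeroSumAt k b v = χ (isZeroSum k (select b v))

zeroSums : ℕ → ℕ → List ℤ → ℕ
zeroSums n k v = Σ∈ (masks n) (λ b → zeroSumAt k b v)

χE≤zeroSums : ∀ k v → χ (E k v) ≤ zeroSums (length v) k v
χE≤zeroSums k v = subst (λ e → χ e ≤ zeroSums (length v) k v) (sym (E≡any-select k v))
  (≤-trans (χ-any≤Σ∈ (isZeroSum k) (map (λ b → select b v) (masks (length v))))
           (≤-reflexive (Σ∈-map (λ b → select b v) (masks (length v)) (χ ∘ isZeroSum k))))

¬E⇒zeroSums≡0 : ∀ k v → E k v ≡ false → zeroSums (length v) k v ≡ 0
¬E⇒zeroSums≡0 k v ¬E = trans (sym (Σ∈-map (λ b → select b v) (masks (length v)) (χ ∘ isZeroSum k)))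
  (¬any⇒Σ∈χ≡0 (isZeroSum k) (map (λ b → select b v) (masks (length v))) (trans (sym (E≡any-select k v)) ¬E))

module _ (u : ℕ) where

  ΣCube-zeroSumAt : ∀ {n} k b → length b ≡ n →
    ΣCube u n (zeroSumAt k b) * D u ^ k ≡ χ (ones b ≡ᵇ k) * (D u ^ n * ways u k (ℤ.+ 0))
  ΣCube-zeroSumAt k b refl with ones b ≡ᵇ k in e
  ... | true = begin
    ΣCube u (length b) (zeroSumAt k b) * D u ^ k
      ≡⟨ cong (_* D u ^ k) (ΣCube-select u b (χ ∘ isZeroSum k)) ⟩
    D u ^ zeros b * ΣCube u (ones b) (χ ∘ isZeroSum k) * D u ^ k
      ≡⟨ cong (λ p → D u ^ zeros b * ΣCube u p (χ ∘ isZeroSum k) * D u ^ k) ones≡k ⟩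
    D u ^ zeros b * ΣCube u k (χ ∘ isZeroSum k) * D u ^ k
      ≡⟨ cong (λ z → D u ^ zeros b * z * D u ^ k) (ΣCube-cong u k (λ v c → isZeroSum-δ k v (InCube-length u k v c))) ⟩
    D u ^ zeros b * ways u k (ℤ.+ 0) * D u ^ k
      ≡⟨ swap (D u ^ zeros b) (ways u k (ℤ.+ 0)) (D u ^ k) ⟩
    1 * (D u ^ zeros b * D u ^ k * ways u k (ℤ.+ 0))
      ≡⟨ cong (λ z → 1 * (z * ways u k (ℤ.+ 0))) (^-distribˡ-+-* (D u) (zeros b) k) ⟨
    1 * (D u ^ (zeros b + k) * ways u k (ℤ.+ 0))
      ≡⟨ cong (λ p → 1 * (D u ^ p * ways u k (ℤ.+ 0))) zeros+k≡length ⟩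
    1 * (D u ^ length b * ways u k (ℤ.+ 0)) ∎
    where
    open ≡-Reasoning
    ones≡k : ones b ≡ k
    ones≡k = ≡ᵇ-true⇒≡ e
    zeros+k≡length : zeros b + k ≡ length b
    zeros+k≡length = trans (cong (zeros b +_) (sym ones≡k)) (zeros+ones≡length b)
    swap : ∀ x z y → x * z * y ≡ 1 * (x * y * z)
    swap = solve-∀
  ... | false = cong (_* D u ^ k) (ΣCube-vanishing u (length b) (λ v c → isZeroSum-length k (select b v)
                  (≡ᵇ-false⇒≢ e ∘ trans (sym (length-select b v (InCube-length u (length b) v c))))))

  ΣCube-zeroSums : ∀ n k → ΣCube u n (zeroSums n k) * D u ^ k ≡ (n C k) * (D u ^ n * ways u k (ℤ.+ 0))
  ΣCube-zeroSums n k = begin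
    ΣCube u n (zeroSums n k) * D u ^ k
      ≡⟨ cong (_* D u ^ k) (ΣCube-Σ∈ u n (masks n) (zeroSumAt k)) ⟩
    Σ∈ (masks n) (λ b → ΣCube u n (zeroSumAt k b)) * D u ^ k
      ≡⟨ Σ∈-*ʳ (masks n) (D u ^ k) _ ⟨
    Σ∈ (masks n) (λ b → ΣCube u n (zeroSumAt k b) * D u ^ k)
      ≡⟨ Σ∈-masks-cong n (ΣCube-zeroSumAt k) ⟩
    Σ∈ (masks n) (λ b → χ (ones b ≡ᵇ k) * (D u ^ n * ways u k (ℤ.+ 0)))
      ≡⟨ Σ∈-*ʳ (masks n) _ (λ b → χ (ones b ≡ᵇ k)) ⟩
    Σ∈ (masks n) (λ b → χ (ones b ≡ᵇ k)) * (D u ^ n * ways u k (ℤ.+ 0))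
      ≡⟨ cong (_* (D u ^ n * ways u k (ℤ.+ 0))) (Σ∈-masks-ones n k) ⟩
    (n C k) * (D u ^ n * ways u k (ℤ.+ 0)) ∎
    where open ≡-Reasoning

  ΣCube-zeroSums≤ : ∀ n k → ΣCube u n (zeroSums n (suc k)) * D u ≤ (n C suc k) * D u ^ n
  ΣCube-zeroSums≤ n k = *-cancelʳ-≤ _ _ (D u ^ k) {{m^n≢0 (D u) k}} (begin
    ΣCube u n (zeroSums n (suc k)) * D u * D u ^ k   ≡⟨ *-assoc (ΣCube u n (zeroSums n (suc k))) (D u) (D u ^ k) ⟩
    ΣCube u n (zeroSums n (suc k)) * D u ^ suc k     ≡⟨ ΣCube-zeroSums n (suc k) ⟩
    (n C suc k) * (D u ^ n * ways u (suc k) (ℤ.+ 0))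
      ≤⟨ *-monoʳ-≤ (n C suc k) (*-monoʳ-≤ (D u ^ n) (ways-suc≤ u k (ℤ.+ 0))) ⟩
    (n C suc k) * (D u ^ n * D u ^ k)                 ≡⟨ *-assoc ((n C suc k)) _ _ ⟨
    (n C suc k) * D u ^ n * D u ^ k                   ∎)
    where open ≤-Reasoning

  module _ (n k : ℕ) where

    D*ΣCube-vanishing : ∀ {f : List ℤ → ℕ} → (∀ v → InCube u n v → f v ≡ 0) → D u * ΣCube u n f ≡ 0
    D*ΣCube-vanishing f≡0 = trans (cong (D u *_) (ΣCube-vanishing u n f≡0)) (*-zeroʳ (D u))

    zeroSumAt-off-weight : ∀ b v → InCube u n v → length b ≡ n → ones b ≢ k → zeroSumAt k b v ≡ 0
    zeroSumAt-off-weight b v c lb ≢k = isZeroSum-length k (select b v)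
      (≢k ∘ trans (sym (length-select b v (trans (InCube-length u n v c) (sym lb)))))

    ΣCube-zeroSumAt-pair : ∀ b b′ → length b ≡ n → length b′ ≡ n →
      D u * ΣCube u n (λ v → zeroSumAt k b v * zeroSumAt k b′ v)
        ≤ (D u * χ (does (b′ ≟ᴮ b)) + χ (ones b′ ≡ᵇ k)) * ΣCube u n (zeroSumAt k b)
    ΣCube-zeroSumAt-pair b b′ lb lb′ with b′ ≟ᴮ b
    ... | yes refl = begin
      D u * ΣCube u n (λ v → zeroSumAt k b v * zeroSumAt k b v)
        ≤⟨ *-monoʳ-≤ (D u) (ΣCube-mono u n (λ v _ → *-monoʳ-≤ (zeroSumAt k b v) (χ≤1 _))) ⟩
      D u * ΣCube u n (λ v → zeroSumAt k b v * 1)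
        ≡⟨ cong (D u *_) (ΣCube-cong u n (λ v _ → *-identityʳ _)) ⟩
      D u * ΣCube u n (zeroSumAt k b)
        ≡⟨ cong (_* ΣCube u n (zeroSumAt k b)) (*-identityʳ (D u)) ⟨
      D u * 1 * ΣCube u n (zeroSumAt k b)
        ≤⟨ *-monoˡ-≤ _ (m≤m+n (D u * 1) _) ⟩
      (D u * 1 + χ (ones b ≡ᵇ k)) * ΣCube u n (zeroSumAt k b) ∎
      where open ≤-Reasoning
    ... | no b′≢b with ones b′ ≡ᵇ k in e′ | ones b ≟ k
    ...   | false | _ = ≤-trans (≤-reflexive (D*ΣCube-vanishing (λ v c →
              trans (cong (zeroSumAt k b v *_) (zeroSumAt-off-weight b′ v c lb′ (≡ᵇ-false⇒≢ e′)))
                    (*-zeroʳ (zeroSumAt k b v))))) z≤n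
    ...   | true | no ones≢k = ≤-trans (≤-reflexive (D*ΣCube-vanishing (λ v c →
              cong (_* zeroSumAt k b′ v) (zeroSumAt-off-weight b v c lb ones≢k)))) z≤n
    ...   | true | yes ones≡k = begin
      D u * ΣCube u n (λ v → zeroSumAt k b v * zeroSumAt k b′ v)
        ≤⟨ *-monoʳ-≤ (D u) (ΣCube-mono u n (λ v _ → *-monoʳ-≤ (zeroSumAt k b v) (isZeroSum≤δ k (select b′ v)))) ⟩
      D u * ΣCube u n (λ v → zeroSumAt k b v * δ (sumℤ (select b′ v)) (ℤ.+ 0))
        ≤⟨ subst (λ m → D u * ΣCube u m _ ≤ ΣCube u m _) lb (ΣCube-⊄ u b b′ b′⊄b (χ ∘ isZeroSum k) (ℤ.+ 0)) ⟩
      ΣCube u n (zeroSumAt k b)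
        ≤⟨ m≤n+m _ (D u * 0 * ΣCube u n (zeroSumAt k b)) ⟩
      D u * 0 * ΣCube u n (zeroSumAt k b) + ΣCube u n (zeroSumAt k b)
        ≡⟨ cong (D u * 0 * ΣCube u n (zeroSumAt k b) +_) (*-identityˡ _) ⟨
      D u * 0 * ΣCube u n (zeroSumAt k b) + 1 * ΣCube u n (zeroSumAt k b)
        ≡⟨ *-distribʳ-+ (ΣCube u n (zeroSumAt k b)) (D u * 0) 1 ⟨
      (D u * 0 + 1) * ΣCube u n (zeroSumAt k b) ∎
      where
      open ≤-Reasoning
      b′⊄b : b′ ⊄ b
      b′⊄b = ⊄-from-ones b b′ (trans lb (sym lb′)) (≤-reflexive (trans ones≡k (sym (≡ᵇ-true⇒≡ e′)))) b′≢b

    ΣCube-zeroSums² : D u * ΣCube u n (λ v → zeroSums n k v * zeroSums n k v) ≤ (D u + n C k) * ΣCube u n (zeroSums n k)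
    ΣCube-zeroSums² = begin
      D u * ΣCube u n (λ v → zeroSums n k v * zeroSums n k v)
        ≡⟨ cong (D u *_) (ΣCube-cong u n (λ v _ → square v)) ⟩
      D u * ΣCube u n (λ v → Σ∈ M (λ b → Σ∈ M (λ b′ → zeroSumAt k b v * zeroSumAt k b′ v)))
        ≡⟨ cong (D u *_) (ΣCube-Σ∈ u n M (λ b v → Σ∈ M (λ b′ → zeroSumAt k b v * zeroSumAt k b′ v))) ⟩
      D u * Σ∈ M (λ b → ΣCube u n (λ v → Σ∈ M (λ b′ → zeroSumAt k b v * zeroSumAt k b′ v)))
        ≡⟨ Σ∈-*ˡ M (D u) _ ⟨
      Σ∈ M (λ b → D u * ΣCube u n (λ v → Σ∈ M (λ b′ → zeroSumAt k b v * zeroSumAt k b′ v)))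
        ≤⟨ Σ∈-masks-mono n (λ b lb → row b lb) ⟩
      Σ∈ M (λ b → (D u + n C k) * ΣCube u n (zeroSumAt k b))
        ≡⟨ Σ∈-*ˡ M (D u + n C k) _ ⟩
      (D u + n C k) * Σ∈ M (λ b → ΣCube u n (zeroSumAt k b))
        ≡⟨ cong ((D u + n C k) *_) (ΣCube-Σ∈ u n M (zeroSumAt k)) ⟨
      (D u + n C k) * ΣCube u n (zeroSums n k) ∎
      where
      open ≤-Reasoning
      M = masks n
      square : ∀ v → zeroSums n k v * zeroSums n k v ≡ Σ∈ M (λ b → Σ∈ M (λ b′ → zeroSumAt k b v * zeroSumAt k b′ v))
      square v = trans (sym (Σ∈-*ʳ M (zeroSums n k v) (λ b → zeroSumAt k b v)))
                       (Σ∈-cong M (λ b → sym (Σ∈-*ˡ M (zeroSumAt k b v) (λ b′ → zeroSumAt k b′ v))))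
      row : ∀ b → length b ≡ n →
            D u * ΣCube u n (λ v → Σ∈ M (λ b′ → zeroSumAt k b v * zeroSumAt k b′ v))
              ≤ (D u + n C k) * ΣCube u n (zeroSumAt k b)
      row b lb = begin
        D u * ΣCube u n (λ v → Σ∈ M (λ b′ → zeroSumAt k b v * zeroSumAt k b′ v))
          ≡⟨ cong (D u *_) (ΣCube-Σ∈ u n M (λ b′ v → zeroSumAt k b v * zeroSumAt k b′ v)) ⟩
        D u * Σ∈ M (λ b′ → ΣCube u n (λ v → zeroSumAt k b v * zeroSumAt k b′ v))
          ≡⟨ Σ∈-*ˡ M (D u) _ ⟨
        Σ∈ M (λ b′ → D u * ΣCube u n (λ v → zeroSumAt k b v * zeroSumAt k b′ v))
          ≤⟨ Σ∈-masks-mono n (λ b′ lb′ → ΣCube-zeroSumAt-pair b b′ lb lb′) ⟩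
        Σ∈ M (λ b′ → (D u * χ (does (b′ ≟ᴮ b)) + χ (ones b′ ≡ᵇ k)) * S)
          ≡⟨ Σ∈-*ʳ M S _ ⟩
        Σ∈ M (λ b′ → D u * χ (does (b′ ≟ᴮ b)) + χ (ones b′ ≡ᵇ k)) * S
          ≡⟨ cong (_* S) (Σ∈-+ M _ _) ⟩
        (Σ∈ M (λ b′ → D u * χ (does (b′ ≟ᴮ b))) + Σ∈ M (λ b′ → χ (ones b′ ≡ᵇ k))) * S
          ≡⟨ cong (_* S) (cong₂ _+_ (Σ∈-*ˡ M (D u) _) (Σ∈-masks-ones n k)) ⟩
        (D u * Σ∈ M (λ b′ → χ (does (b′ ≟ᴮ b))) + n C k) * S
          ≤⟨ *-monoˡ-≤ S (+-monoˡ-≤ (n C k) (*-monoʳ-≤ (D u) (Σ∈-masks-≡ n b))) ⟩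
        (D u * 1 + n C k) * S
          ≡⟨ cong (λ d → (d + n C k) * S) (*-identityʳ (D u)) ⟩
        (D u + n C k) * S ∎
        where
        S = ΣCube u n (zeroSumAt k b)

2ab≤a²+b² : ∀ a b → 2 * (a * b) ≤ a * a + b * b
2ab≤a²+b² a b = [ ordered , (λ b≤a → subst₂ _≤_ (cong (2 *_) (*-comm b a)) (+-comm (b * b) (a * a)) (ordered b≤a)) ]′
                (≤-total a b)
  where
  expand : ∀ a d → 2 * (a * (a + d)) + d * d ≡ a * a + (a + d) * (a + d)
  expand = solve-∀
  ordered : ∀ {a b} → a ≤ b → 2 * (a * b) ≤ a * a + b * b
  ordered {a} {b} a≤b = subst (λ b → 2 * (a * b) ≤ a * a + b * b) (m+[n∸m]≡n a≤b)
                              (subst (2 * (a * (a + (b ∸ a))) ≤_) (expand a (b ∸ a)) (m≤m+n _ ((b ∸ a) * (b ∸ a))))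

n≤n*n : ∀ n → n ≤ n * n
n≤n*n zero    = z≤n
n≤n*n (suc n) = m≤m*n (suc n) (suc n)

m²≤fs-by-AM-GM : ∀ s m f → m ≤ s → 2 * (s * (m * m)) ≤ s * s * f + m * m * s → m * m ≤ f * s
m²≤fs-by-AM-GM zero    zero f _ _ = z≤n
m²≤fs-by-AM-GM (suc s) m    f _ h = *-cancelˡ-≤ (suc s) (subst (suc s * (m * m) ≤_) (cong (suc s *_) (*-comm (suc s) f))
  (+-cancelʳ-≤ (suc s * (m * m)) (suc s * (m * m)) (suc s * (suc s * f)) (subst₂ _≤_ (double (suc s) m) (regroup (suc s) m f) h)))
  where
  double : ∀ s m → 2 * (s * (m * m)) ≡ s * (m * m) + s * (m * m)
  double = solve-∀
  regroup : ∀ s m f → s * s * f + m * m * s ≡ s * (s * f) + s * (m * m)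
  regroup = solve-∀

module _ (u : ℕ) where

  -- Cauchy–Schwarz, from the pointwise AM–GM bound 2σμ f ≤ σ²[e] + μ² f², which holds
  -- because f vanishes where e fails.
  second-moment : ∀ n (e : List ℤ → Bool) (f : List ℤ → ℕ) → (∀ v → InCube u n v → e v ≡ false → f v ≡ 0) →
                  ΣCube u n f * ΣCube u n f ≤ ΣCube u n (χ ∘ e) * ΣCube u n (λ v → f v * f v)
  second-moment n e f support = m²≤fs-by-AM-GM σ μ F (ΣCube-mono u n (λ v _ → n≤n*n (f v))) (begin
    2 * (σ * (μ * μ))                                 ≡⟨ cong (λ z → 2 * (σ * z)) (ΣCube-*ˡ u n μ f) ⟨
    2 * (σ * ΣCube u n (λ v → μ * f v))               ≡⟨ cong (2 *_) (ΣCube-*ˡ u n σ (λ v → μ * f v)) ⟨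
    2 * ΣCube u n (λ v → σ * (μ * f v))               ≡⟨ ΣCube-*ˡ u n 2 (λ v → σ * (μ * f v)) ⟨
    ΣCube u n (λ v → 2 * (σ * (μ * f v)))             ≤⟨ ΣCube-mono u n pointwise ⟩
    ΣCube u n (λ v → σ * σ * χ (e v) + μ * μ * (f v * f v))
      ≡⟨ ΣCube-+ u n (λ v → σ * σ * χ (e v)) (λ v → μ * μ * (f v * f v)) ⟩
    ΣCube u n (λ v → σ * σ * χ (e v)) + ΣCube u n (λ v → μ * μ * (f v * f v))
      ≡⟨ cong₂ _+_ (ΣCube-*ˡ u n (σ * σ) (χ ∘ e)) (ΣCube-*ˡ u n (μ * μ) (λ v → f v * f v)) ⟩
    σ * σ * F + μ * μ * σ                             ∎)
    where
    open ≤-Reasoning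
    μ = ΣCube u n f
    σ = ΣCube u n (λ v → f v * f v)
    F = ΣCube u n (χ ∘ e)
    regroup : ∀ s m x → s * s + m * x * (m * x) ≡ s * s * 1 + m * m * (x * x)
    regroup = solve-∀
    pointwise : ∀ v → InCube u n v → 2 * (σ * (μ * f v)) ≤ σ * σ * χ (e v) + μ * μ * (f v * f v)
    pointwise v c with e v in ev
    ... | true  = subst (2 * (σ * (μ * f v)) ≤_) (regroup σ μ (f v)) (2ab≤a²+b² σ (μ * f v))
    ... | false rewrite support v c ev | *-zeroʳ μ | *-zeroʳ σ = z≤n

  1+2ku≤k*D : ∀ {k} → 1 ≤ k → suc (2 * (k * u)) ≤ k * D u
  1+2ku≤k*D (s≤s {n = k′} z≤n) = subst (suc (2 * (suc k′ * u)) ≤_) (expand k′ u) (m≤m+n _ k′)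
    where
    expand : ∀ k u → suc (2 * (suc k * u)) + k ≡ suc k * suc (2 * u)
    expand = solve-∀

  module _ (n k : ℕ) where

    private
      μ = ΣCube u n (zeroSums n k)
      σ = ΣCube u n (λ v → zeroSums n k v * zeroSums n k v)
      F = ΣCube u n (χ ∘ E k)
      M = suc (2 * (k * u))

    C*D^n≤M*μ : (n C k) * D u ^ n ≤ M * μ
    C*D^n≤M*μ = *-cancelˡ-≤ (D u ^ k) {{m^n≢0 (D u) k}} (begin
      D u ^ k * ((n C k) * D u ^ n)   ≡⟨ *-comm (D u ^ k) _ ⟩
      (n C k) * D u ^ n * D u ^ k     ≤⟨ *-monoʳ-≤ ((n C k) * D u ^ n) (D^j≤[2ju+1]*ways-zero u k) ⟩
      (n C k) * D u ^ n * (M * Z)     ≡⟨ regroup (n C k) (D u ^ n) M Z ⟩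
      M * ((n C k) * (D u ^ n * Z))   ≡⟨ cong (M *_) (ΣCube-zeroSums u n k) ⟨
      M * (μ * D u ^ k)               ≡⟨ regroup′ M μ (D u ^ k) ⟩
      D u ^ k * (M * μ)               ∎)
      where
      open ≤-Reasoning
      Z = ways u k (ℤ.+ 0)
      regroup : ∀ c d m z → c * d * (m * z) ≡ m * (c * (d * z))
      regroup = solve-∀
      regroup′ : ∀ m a d → m * (a * d) ≡ d * (m * a)
      regroup′ = solve-∀

    D*μ≤F*[D+C] : D u * μ ≤ F * (D u + n C k)
    D*μ≤F*[D+C] with μ in eμ
    ... | zero   = ≤-trans (≤-reflexive (*-zeroʳ (D u))) z≤n
    ... | suc μ′ = *-cancelˡ-≤ (suc μ′) (begin
      suc μ′ * (D u * suc μ′)        ≡⟨ regroup (suc μ′) (D u) ⟩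
      D u * (suc μ′ * suc μ′)
        ≤⟨ *-monoʳ-≤ (D u) (subst (λ m → m * m ≤ F * σ) eμ (second-moment n (E k) (zeroSums n k) support)) ⟩
      D u * (F * σ)                  ≡⟨ regroup′ (D u) F σ ⟩
      F * (D u * σ)                  ≤⟨ *-monoʳ-≤ F (ΣCube-zeroSums² u n k) ⟩
      F * ((D u + n C k) * μ)        ≡⟨ cong (λ m → F * ((D u + n C k) * m)) eμ ⟩
      F * ((D u + n C k) * suc μ′)   ≡⟨ regroup″ F (D u + n C k) (suc μ′) ⟩
      suc μ′ * (F * (D u + n C k))   ∎)
      where
      open ≤-Reasoning
      support : ∀ v → InCube u n v → E k v ≡ false → zeroSums n k v ≡ 0
      support v c ¬E = subst (λ m → zeroSums m k v ≡ 0) (InCube-length u n v c) (¬E⇒zeroSums≡0 k v ¬E)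
      regroup : ∀ m d → m * (d * m) ≡ d * (m * m)
      regroup = solve-∀
      regroup′ : ∀ d f s → d * (f * s) ≡ f * (d * s)
      regroup′ = solve-∀
      regroup″ : ∀ f c m → f * (c * m) ≡ m * (f * c)
      regroup″ = solve-∀

    block-success : 1 ≤ k → D u ≤ n C k → D u ^ n ≤ F * (2 * k)
    block-success 1≤k D≤C = *-cancelˡ-≤ (D u * (n C k)) {{DC≢0}} (begin
      D u * (n C k) * D u ^ n            ≡⟨ *-assoc (D u) (n C k) (D u ^ n) ⟩
      D u * ((n C k) * D u ^ n)          ≤⟨ *-monoʳ-≤ (D u) C*D^n≤M*μ ⟩
      D u * (M * μ)                      ≡⟨ regroup (D u) M μ ⟩
      D u * μ * M                        ≤⟨ *-mono-≤ D*μ≤F*[D+C] (1+2ku≤k*D 1≤k) ⟩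
      F * (D u + n C k) * (k * D u)      ≤⟨ *-monoˡ-≤ (k * D u) (*-monoʳ-≤ F (+-monoˡ-≤ (n C k) D≤C)) ⟩
      F * (n C k + n C k) * (k * D u)    ≡⟨ regroup′ F (n C k) k (D u) ⟩
      D u * (n C k) * (F * (2 * k))      ∎)
      where
      open ≤-Reasoning
      DC≢0 : ℕ.NonZero (D u * (n C k))
      DC≢0 = m*n≢0 (D u) (n C k) {{_}} {{ℕ.>-nonZero (≤-trans (s≤s z≤n) D≤C)}}
      regroup : ∀ d m a → d * (m * a) ≡ d * a * m
      regroup = solve-∀
      regroup′ : ∀ f c k d → f * (c + c) * (k * d) ≡ d * c * (f * (2 * k))
      regroup′ = solve-∀

-- Independent blocks

^-distrib-* : ∀ a b k → (a * b) ^ k ≡ a ^ k * b ^ k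
^-distrib-* a b zero    = refl
^-distrib-* a b (suc k) = trans (cong (a * b *_) (^-distrib-* a b k)) (interchange′ a b (a ^ k) (b ^ k))
  where
  interchange′ : ∀ a b x y → a * b * (x * y) ≡ a * x * (b * y)
  interchange′ = solve-∀

module _ (u k : ℕ) where

  failures : ℕ → ℕ
  failures n = ΣCube u n (χ ∘ not ∘ E k)

  failures+successes : ∀ n → failures n + ΣCube u n (χ ∘ E k) ≡ D u ^ n
  failures+successes n = begin
    failures n + ΣCube u n (χ ∘ E k)                  ≡⟨ ΣCube-+ u n (χ ∘ not ∘ E k) (χ ∘ E k) ⟨
    ΣCube u n (λ v → χ (not (E k v)) + χ (E k v))     ≡⟨ ΣCube-cong u n (λ v _ → χ-not+χ (E k v)) ⟩
    ΣCube u n (λ _ → 1)                               ≡⟨ ΣCube-one u n ⟩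
    D u ^ n                                           ∎
    where
    open ≡-Reasoning
    χ-not+χ : ∀ b → χ (not b) + χ b ≡ 1
    χ-not+χ true  = refl
    χ-not+χ false = refl

  failures≤ : ∀ n → failures n ≤ D u ^ n
  failures≤ n = subst (failures n ≤_) (failures+successes n) (m≤m+n _ _)

  failures-++ : ∀ a b → failures (a + b) ≤ failures a * failures b
  failures-++ a b = begin
    failures (a + b)
      ≡⟨ ΣCube-++ u a b (χ ∘ not ∘ E k) ⟩
    ΣCube u a (λ v → ΣCube u b (λ w → χ (not (E k (v ++ w)))))
      ≤⟨ ΣCube-mono u a (λ v _ → ΣCube-mono u b (λ w _ → χ¬E-++ k v w)) ⟩
    ΣCube u a (λ v → ΣCube u b (λ w → χ (not (E k v)) * χ (not (E k w))))
      ≡⟨ ΣCube-cong u a (λ v _ → ΣCube-*ˡ u b (χ (not (E k v))) (χ ∘ not ∘ E k)) ⟩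
    ΣCube u a (λ v → χ (not (E k v)) * failures b)
      ≡⟨ ΣCube-cong u a (λ v _ → *-comm (χ (not (E k v))) (failures b)) ⟩
    ΣCube u a (λ v → failures b * χ (not (E k v)))
      ≡⟨ ΣCube-*ˡ u a (failures b) (χ ∘ not ∘ E k) ⟩
    failures b * failures a
      ≡⟨ *-comm (failures b) _ ⟩
    failures a * failures b
      ∎
    where open ≤-Reasoning

  failures-blocks : ∀ n q r → failures (q * n + r) ≤ failures n ^ q * D u ^ r
  failures-blocks n zero    r = subst (failures r ≤_) (sym (*-identityˡ _)) (failures≤ r)
  failures-blocks n (suc q) r = begin
    failures (n + q * n + r)                  ≡⟨ cong failures (+-assoc n (q * n) r) ⟩
    failures (n + (q * n + r))                ≤⟨ failures-++ n (q * n + r) ⟩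
    failures n * failures (q * n + r)         ≤⟨ *-monoʳ-≤ (failures n) (failures-blocks n q r) ⟩
    failures n * (failures n ^ q * D u ^ r)   ≡⟨ *-assoc (failures n) _ _ ⟨
    failures n ^ suc q * D u ^ r              ∎
    where open ≤-Reasoning

  -- A block succeeds with probability at least 1/(2k); the statement only asks for 1/(4k+2).
  failures-block : ∀ n → 1 ≤ k → D u ≤ n C k → failures n * suc (suc (4 * k)) ≤ D u ^ n * suc (4 * k)
  failures-block n 1≤k D≤C = +-cancelʳ-≤ (D u ^ n) _ _ (begin
    failures n * suc (suc (4 * k)) + D u ^ n    ≤⟨ +-monoʳ-≤ _ D^n≤S*[4k+2] ⟩
    failures n * suc (suc (4 * k)) + S * suc (suc (4 * k))
                                                ≡⟨ *-distribʳ-+ (suc (suc (4 * k))) (failures n) S ⟨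
    (failures n + S) * suc (suc (4 * k))        ≡⟨ cong (_* suc (suc (4 * k))) (failures+successes n) ⟩
    D u ^ n * suc (suc (4 * k))                 ≡⟨ *-suc (D u ^ n) (suc (4 * k)) ⟩
    D u ^ n + D u ^ n * suc (4 * k)             ≡⟨ +-comm (D u ^ n) _ ⟩
    D u ^ n * suc (4 * k) + D u ^ n             ∎)
    where
    open ≤-Reasoning
    S = ΣCube u n (χ ∘ E k)
    2k≤4k+2 : 2 * k ≤ suc (suc (4 * k))
    2k≤4k+2 = m≤n⇒m≤1+n (m≤n⇒m≤1+n (*-monoˡ-≤ k (s≤s (s≤s (z≤n {2})))))
    D^n≤S*[4k+2] : D u ^ n ≤ S * suc (suc (4 * k))
    D^n≤S*[4k+2] = ≤-trans (block-success u n k 1≤k D≤C) (*-monoʳ-≤ S 2k≤4k+2)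

  failures-bound : ∀ m n q r → m ≡ q * n + r → 1 ≤ k → D u ≤ n C k →
                   failures m * suc (suc (4 * k)) ^ q ≤ D u ^ m * suc (4 * k) ^ q
  failures-bound m n q r refl 1≤k D≤C = begin
    failures m * a ^ q                        ≤⟨ *-monoˡ-≤ (a ^ q) (failures-blocks n q r) ⟩
    failures n ^ q * D u ^ r * a ^ q          ≡⟨ regroup (failures n ^ q) (D u ^ r) (a ^ q) ⟩
    failures n ^ q * a ^ q * D u ^ r          ≡⟨ cong (_* D u ^ r) (^-distrib-* (failures n) a q) ⟨
    (failures n * a) ^ q * D u ^ r            ≤⟨ *-monoˡ-≤ (D u ^ r) (^-monoˡ-≤ q (failures-block n 1≤k D≤C)) ⟩
    (D u ^ n * b) ^ q * D u ^ r               ≡⟨ cong (_* D u ^ r) (^-distrib-* (D u ^ n) b q) ⟩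
    (D u ^ n) ^ q * b ^ q * D u ^ r           ≡⟨ regroup ((D u ^ n) ^ q) (b ^ q) (D u ^ r) ⟩
    (D u ^ n) ^ q * D u ^ r * b ^ q           ≡⟨ cong (λ x → x * D u ^ r * b ^ q) (^-*-assoc (D u) n q) ⟩
    D u ^ (n * q) * D u ^ r * b ^ q           ≡⟨ cong (_* b ^ q) (^-distribˡ-+-* (D u) (n * q) r) ⟨
    D u ^ (n * q + r) * b ^ q                 ≡⟨ cong (λ x → D u ^ (x + r) * b ^ q) (*-comm n q) ⟩
    D u ^ (q * n + r) * b ^ q                 ∎
    where
    open ≤-Reasoning
    a = suc (suc (4 * k))
    b = suc (4 * k)
    regroup : ∀ x y z → x * y * z ≡ x * z * y
    regroup = solve-∀

-- Binomial estimates and the block length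

[1+k]*[1+n]C[1+k]≡[1+n]*nCk : ∀ n k → suc k * (suc n C suc k) ≡ suc n * (n C k)
[1+k]*[1+n]C[1+k]≡[1+n]*nCk zero    zero    = refl
[1+k]*[1+n]C[1+k]≡[1+n]*nCk zero    (suc k) =
  trans (cong (suc (suc k) *_) (k>n⇒nCk≡0 {1} {suc (suc k)} (s≤s (s≤s z≤n)))) (*-zeroʳ (suc (suc k)))
[1+k]*[1+n]C[1+k]≡[1+n]*nCk (suc n) zero    = trans (*-identityˡ _) (trans (nC1≡n (suc (suc n))) (sym (*-identityʳ _)))
[1+k]*[1+n]C[1+k]≡[1+n]*nCk (suc n) (suc k) = begin
  suc (suc k) * (suc (suc n) C suc (suc k))
    ≡⟨ cong (suc (suc k) *_) (nCk+nC[k+1]≡[n+1]C[k+1] (suc n) (suc k)) ⟨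
  suc (suc k) * (B + (suc n C suc (suc k)))
    ≡⟨ *-distribˡ-+ (suc (suc k)) B _ ⟩
  suc (suc k) * B + suc (suc k) * (suc n C suc (suc k))
    ≡⟨ cong₂ _+_ (cong (B +_) ([1+k]*[1+n]C[1+k]≡[1+n]*nCk n k)) ([1+k]*[1+n]C[1+k]≡[1+n]*nCk n (suc k)) ⟩
  B + suc n * (n C k) + suc n * (n C suc k)
    ≡⟨ +-assoc B _ _ ⟩
  B + (suc n * (n C k) + suc n * (n C suc k))
    ≡⟨ cong (B +_) (*-distribˡ-+ (suc n) (n C k) _) ⟨
  B + suc n * ((n C k) + (n C suc k))
    ≡⟨ cong (λ x → B + suc n * x) (nCk+nC[k+1]≡[n+1]C[k+1] n k) ⟩
  suc (suc n) * B ∎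
  where
  open ≡-Reasoning
  B = suc n C suc k

n^k≤nCk*k^k : ∀ n k → k ≤ n → n ^ k ≤ (n C k) * k ^ k
n^k≤nCk*k^k n       zero          _          = s≤s z≤n
n^k≤nCk*k^k (suc n) (suc zero)    _          =
  ≤-reflexive (sym (trans (*-identityʳ _) (trans (nC1≡n (suc n)) (sym (*-identityʳ _)))))
n^k≤nCk*k^k (suc n) (suc (suc k)) (s≤s k<n) = begin
  suc n * suc n ^ K                  ≤⟨ *-monoʳ-≤ (suc n) [1+n]^K≤nCK*[1+K]^K ⟩
  suc n * ((n C K) * suc K ^ K)      ≡⟨ *-assoc (suc n) (n C K) _ ⟨
  suc n * (n C K) * suc K ^ K        ≡⟨ cong (_* suc K ^ K) ([1+k]*[1+n]C[1+k]≡[1+n]*nCk n K) ⟨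
  suc K * (suc n C suc K) * suc K ^ K ≡⟨ regroup (suc K) (suc n C suc K) (suc K ^ K) ⟩
  (suc n C suc K) * suc K ^ suc K    ∎
  where
  open ≤-Reasoning
  K = suc k
  regroup : ∀ a b c → a * b * c ≡ b * (a * c)
  regroup = solve-∀
  [1+n]*K≤n*[1+K] : suc n * K ≤ n * suc K
  [1+n]*K≤n*[1+K] = subst₂ _≤_ (l n K) (r n K) (+-monoʳ-≤ (n * K) k<n)
    where
    l : ∀ n K → n * K + K ≡ suc n * K
    l = solve-∀
    r : ∀ n K → n * K + n ≡ n * suc K
    r = solve-∀
  [1+n]^K≤nCK*[1+K]^K : suc n ^ K ≤ (n C K) * suc K ^ K
  [1+n]^K≤nCK*[1+K]^K = *-cancelˡ-≤ (K ^ K) {{m^n≢0 K K}} (begin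
    K ^ K * suc n ^ K               ≡⟨ *-comm (K ^ K) _ ⟩
    suc n ^ K * K ^ K               ≡⟨ ^-distrib-* (suc n) K K ⟨
    (suc n * K) ^ K                 ≤⟨ ^-monoˡ-≤ K [1+n]*K≤n*[1+K] ⟩
    (n * suc K) ^ K                 ≡⟨ ^-distrib-* n (suc K) K ⟩
    n ^ K * suc K ^ K               ≤⟨ *-monoˡ-≤ (suc K ^ K) (n^k≤nCk*k^k n K k<n) ⟩
    (n C K) * K ^ K * suc K ^ K     ≡⟨ regroup′ (n C K) (K ^ K) (suc K ^ K) ⟩
    K ^ K * ((n C K) * suc K ^ K)   ∎)
    where
    regroup′ : ∀ a b c → a * b * c ≡ b * (a * c)
    regroup′ = solve-∀

bernoulli : ∀ b c j → (b + c) ^ suc j ≤ c ^ j * (b + c) + j * b * (b + c) ^ j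
bernoulli b c zero    = ≤-reflexive (trans (*-identityʳ (b + c)) (sym (trans (+-identityʳ _) (*-identityˡ (b + c)))))
bernoulli b c (suc j) = begin
  a * a ^ suc j                                          ≡⟨ *-distribʳ-+ (a ^ suc j) b c ⟩
  b * a ^ suc j + c * a ^ suc j                          ≤⟨ +-monoʳ-≤ (b * a ^ suc j) (*-monoʳ-≤ c (bernoulli b c j)) ⟩
  b * a ^ suc j + c * (c ^ j * a + j * b * a ^ j)        ≡⟨ expand b c a (c ^ j) (a ^ j) j ⟩
  c ^ suc j * a + b * a ^ suc j + j * b * (c * a ^ j)
    ≤⟨ +-monoʳ-≤ (c ^ suc j * a + b * a ^ suc j) (*-monoʳ-≤ (j * b) (*-monoˡ-≤ (a ^ j) (m≤n+m c b))) ⟩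
  c ^ suc j * a + b * a ^ suc j + j * b * (a * a ^ j)    ≡⟨ collect b c a (c ^ j) (a ^ j) j ⟩
  c ^ suc j * a + suc j * b * a ^ suc j                  ∎
  where
  open ≤-Reasoning
  a = b + c
  expand : ∀ b c a cj aj j → b * (a * aj) + c * (cj * a + j * b * aj) ≡ c * cj * a + b * (a * aj) + j * b * (c * aj)
  expand = solve-∀
  collect : ∀ b c a cj aj j → c * cj * a + b * (a * aj) + j * b * (a * aj) ≡ c * cj * a + suc j * b * (a * aj)
  collect = solve-∀

[1+n]^j≤2*n^j : ∀ n j → 2 * j ≤ suc n → suc n ^ j ≤ 2 * n ^ j
[1+n]^j≤2*n^j n j 2j≤1+n = *-cancelˡ-≤ (suc n) (+-cancelʳ-≤ (suc n * a^j) _ _ (begin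
  suc n * a^j + suc n * a^j               ≡⟨ double (suc n * a^j) ⟩
  2 * (suc n * a^j)                       ≤⟨ *-monoʳ-≤ 2 (bernoulli 1 n j) ⟩
  2 * (n ^ j * suc n + j * 1 * a^j)       ≡⟨ spread (n ^ j) (suc n) j a^j ⟩
  suc n * (2 * n ^ j) + 2 * j * a^j       ≤⟨ +-monoʳ-≤ (suc n * (2 * n ^ j)) (*-monoˡ-≤ a^j 2j≤1+n) ⟩
  suc n * (2 * n ^ j) + suc n * a^j       ∎))
  where
  open ≤-Reasoning
  a^j = suc n ^ j
  double : ∀ x → x + x ≡ 2 * x
  double = solve-∀
  spread : ∀ x a j y → 2 * (x * a + j * 1 * y) ≡ a * (2 * x) + 2 * j * y
  spread = solve-∀

2*⌊n/2⌋≤n : ∀ n → 2 * ℕ.⌊ n /2⌋ ≤ n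
2*⌊n/2⌋≤n zero          = z≤n
2*⌊n/2⌋≤n (suc zero)    = z≤n
2*⌊n/2⌋≤n (suc (suc n)) = subst (_≤ suc (suc n)) (sym (*-suc 2 ℕ.⌊ n /2⌋)) (s≤s (s≤s (2*⌊n/2⌋≤n n)))

[1+n]^k≤4*n^k : ∀ n k → k ≤ n → suc n ^ k ≤ 4 * n ^ k
[1+n]^k≤4*n^k n k k≤n = begin
  suc n ^ k                              ≡⟨ cong (suc n ^_) (⌊n/2⌋+⌈n/2⌉≡n k) ⟨
  suc n ^ (⌊k/2⌋ + ⌈k/2⌉)                ≡⟨ ^-distribˡ-+-* (suc n) ⌊k/2⌋ ⌈k/2⌉ ⟩
  suc n ^ ⌊k/2⌋ * suc n ^ ⌈k/2⌉
    ≤⟨ *-mono-≤ ([1+n]^j≤2*n^j n ⌊k/2⌋ 2⌊k/2⌋≤1+n) ([1+n]^j≤2*n^j n ⌈k/2⌉ 2⌈k/2⌉≤1+n) ⟩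
  2 * n ^ ⌊k/2⌋ * (2 * n ^ ⌈k/2⌉)        ≡⟨ regroup (n ^ ⌊k/2⌋) (n ^ ⌈k/2⌉) ⟩
  4 * (n ^ ⌊k/2⌋ * n ^ ⌈k/2⌉)            ≡⟨ cong (4 *_) (^-distribˡ-+-* n ⌊k/2⌋ ⌈k/2⌉) ⟨
  4 * n ^ (⌊k/2⌋ + ⌈k/2⌉)                ≡⟨ cong (λ i → 4 * n ^ i) (⌊n/2⌋+⌈n/2⌉≡n k) ⟩
  4 * n ^ k                              ∎
  where
  open ≤-Reasoning
  ⌊k/2⌋ = ℕ.⌊ k /2⌋
  ⌈k/2⌉ = ℕ.⌈ k /2⌉
  2⌈k/2⌉≤1+n : 2 * ⌈k/2⌉ ≤ suc n
  2⌈k/2⌉≤1+n = ≤-trans (2*⌊n/2⌋≤n (suc k)) (s≤s k≤n)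
  2⌊k/2⌋≤1+n : 2 * ⌊k/2⌋ ≤ suc n
  2⌊k/2⌋≤1+n = ≤-trans (*-monoʳ-≤ 2 (⌊n/2⌋≤⌈n/2⌉ k)) 2⌈k/2⌉≤1+n
  regroup : ∀ x y → 2 * x * (2 * y) ≡ 4 * (x * y)
  regroup = solve-∀

block-decomposition : ∀ u m k q → .{{ℕ.NonZero k}} → .{{ℕ.NonZero q}} → (q * k) ^ k * (20 * u + 10) ≤ m ^ k →
                      ∃[ n ] ∃[ r ] m ≡ q * n + r × D u ≤ n C k
block-decomposition u m k q hyp = n , r , m≡qn+r , D≤C
  where
  open ≤-Reasoning
  n = m ℕ./ q
  r = m ℕ.% q
  m≡qn+r : m ≡ q * n + r
  m≡qn+r = trans (ℕ.m≡m%n+[m/n]*n m q) (trans (+-comm r (n * q)) (cong (_+ r) (*-comm n q)))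
  m<[1+n]q : m < suc n * q
  m<[1+n]q = subst (_< suc n * q) (sym (ℕ.m≡m%n+[m/n]*n m q)) (+-monoˡ-< (n * q) (ℕ.m%n<n m q))
  k^k*10D<[1+n]^k : k ^ k * (10 * D u) < suc n ^ k
  k^k*10D<[1+n]^k = *-cancelˡ-< (q ^ k) _ _ (begin-strict
    q ^ k * (k ^ k * (10 * D u))     ≡⟨ *-assoc (q ^ k) (k ^ k) _ ⟨
    q ^ k * k ^ k * (10 * D u)       ≡⟨ cong₂ _*_ (^-distrib-* q k k) (20u+10≡10D u) ⟨
    (q * k) ^ k * (20 * u + 10)      ≤⟨ hyp ⟩
    m ^ k                            <⟨ ^-monoˡ-< k m<[1+n]q ⟩
    (suc n * q) ^ k                  ≡⟨ trans (^-distrib-* (suc n) q k) (*-comm (suc n ^ k) (q ^ k)) ⟩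
    q ^ k * suc n ^ k                ∎)
    where
    20u+10≡10D : ∀ u → 20 * u + 10 ≡ 10 * suc (2 * u)
    20u+10≡10D = solve-∀
  k≤n : k ≤ n
  k≤n with k ≤? n
  ... | yes k≤n = k≤n
  ... | no  k≰n = contradiction k^k*10D<[1+n]^k (≤⇒≯ (begin
        suc n ^ k          ≤⟨ ^-monoˡ-≤ k (≰⇒> k≰n) ⟩
        k ^ k              ≤⟨ m≤m*n (k ^ k) (10 * D u) ⟩
        k ^ k * (10 * D u) ∎))
  10D<4C : 10 * D u < 4 * (n C k)
  10D<4C = *-cancelˡ-< (k ^ k) _ _ (begin-strict
    k ^ k * (10 * D u)           <⟨ k^k*10D<[1+n]^k ⟩
    suc n ^ k                    ≤⟨ [1+n]^k≤4*n^k n k k≤n ⟩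
    4 * n ^ k                    ≤⟨ *-monoʳ-≤ 4 (n^k≤nCk*k^k n k k≤n) ⟩
    4 * ((n C k) * k ^ k)        ≡⟨ regroup (k ^ k) (n C k) ⟩
    k ^ k * (4 * (n C k))        ∎)
    where
    regroup : ∀ x c → 4 * (c * x) ≡ x * (4 * c)
    regroup = solve-∀
  D≤C : D u ≤ n C k
  D≤C = *-cancelˡ-≤ 4 (≤-trans (*-monoˡ-≤ (D u) (s≤s (s≤s (s≤s (s≤s (z≤n {6})))))) (<⇒≤ 10D<4C))

-- Rationals and the exponential series

ℚ-ring : AlmostCommutativeRing 0ℓ 0ℓ
ℚ-ring = fromCommutativeRing ℚP.+-*-commutativeRing (λ x → dec⇒maybe (0ℚ ℚP.≟ x))

infix 7.5 _÷_
_÷_ : ℕ → (b : ℕ) → .{{ℕ.NonZero b}} → ℚ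
a ÷ b = ℤ.+ a / b

toℚᵘ-÷ : ∀ a b′ → toℚᵘ (a ÷ suc b′) ℚᵘ.≃ ℚᵘ.mkℚᵘ (ℤ.+ a) b′
toℚᵘ-÷ a b′ = ℚP.toℚᵘ-fromℚᵘ (ℚᵘ.mkℚᵘ (ℤ.+ a) b′)

÷-mono-≤ : ∀ a b c e .{{_ : ℕ.NonZero b}} .{{_ : ℕ.NonZero e}} → a * e ≤ c * b → a ÷ b ℚ.≤ c ÷ e
÷-mono-≤ a (suc b′) c (suc e′) ae≤cb = ℚP.toℚᵘ-cancel-≤
  (ℚᵘP.≤-respˡ-≃ (ℚᵘP.≃-sym (toℚᵘ-÷ a b′)) (ℚᵘP.≤-respʳ-≃ (ℚᵘP.≃-sym (toℚᵘ-÷ c e′))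
    (ℚᵘ.*≤* (subst₂ ℤ._≤_ (ℤP.pos-* a (suc e′)) (ℤP.pos-* c (suc b′)) (ℤ.+≤+ ae≤cb)))))

÷-cong : ∀ a b c e .{{_ : ℕ.NonZero b}} .{{_ : ℕ.NonZero e}} → a * e ≡ c * b → a ÷ b ≡ c ÷ e
÷-cong a b c e ae≡cb =
  ℚP.≤-antisym (÷-mono-≤ a b c e (≤-reflexive ae≡cb)) (÷-mono-≤ c e a b (≤-reflexive (sym ae≡cb)))

÷-+ : ∀ a b c e .{{_ : ℕ.NonZero b}} .{{_ : ℕ.NonZero e}} →
      a ÷ b ℚ.+ c ÷ e ≡ ((a * e + c * b) ÷ (b * e)) {{m*n≢0 b e}}
÷-+ a (suc b′) c (suc e′) = ℚP.toℚᵘ-injective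
  (ℚᵘP.≃-trans (ℚP.toℚᵘ-homo-+ (a ÷ suc b′) (c ÷ suc e′))
  (ℚᵘP.≃-trans (ℚᵘP.+-cong (toℚᵘ-÷ a b′) (toℚᵘ-÷ c e′))
  (ℚᵘP.≃-sym (ℚᵘP.≃-trans (toℚᵘ-÷ (a * suc e′ + c * suc b′) (e′ + b′ * suc e′))
                          (ℚᵘ.*≡* (cong (ℤ._* ℤ.+ (suc b′ * suc e′)) numerator))))))
  where
  numerator : ℤ.+ (a * suc e′ + c * suc b′) ≡ ℤ.+ a ℤ.* ℤ.+ suc e′ ℤ.+ ℤ.+ c ℤ.* ℤ.+ suc b′
  numerator = trans (ℤP.pos-+ (a * suc e′) (c * suc b′)) (cong₂ ℤ._+_ (ℤP.pos-* a (suc e′)) (ℤP.pos-* c (suc b′)))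

÷-* : ∀ a b c e .{{_ : ℕ.NonZero b}} .{{_ : ℕ.NonZero e}} →
      a ÷ b ℚ.* c ÷ e ≡ ((a * c) ÷ (b * e)) {{m*n≢0 b e}}
÷-* a (suc b′) c (suc e′) = ℚP.toℚᵘ-injective
  (ℚᵘP.≃-trans (ℚP.toℚᵘ-homo-* (a ÷ suc b′) (c ÷ suc e′))
  (ℚᵘP.≃-trans (ℚᵘP.*-cong (toℚᵘ-÷ a b′) (toℚᵘ-÷ c e′))
  (ℚᵘP.≃-sym (ℚᵘP.≃-trans (toℚᵘ-÷ (a * c) (e′ + b′ * suc e′))
                          (ℚᵘ.*≡* (cong (ℤ._* ℤ.+ (suc b′ * suc e′)) (ℤP.pos-* a c)))))))

0≤÷ : ∀ a b .{{_ : ℕ.NonZero b}} → 0ℚ ℚ.≤ a ÷ b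
0≤÷ a b = ÷-mono-≤ 0 1 a b z≤n

multichoose : ℕ → ℕ → ℕ
multichoose zero    zero    = 1
multichoose zero    (suc j) = 0
multichoose (suc q) j       = (q + j) C j

multichoose-zero : ∀ q → multichoose q 0 ≡ 1
multichoose-zero zero    = refl
multichoose-zero (suc q) = refl

multichoose-pascal : ∀ q j → multichoose (suc q) (suc j) ≡ multichoose (suc q) j + multichoose q (suc j)
multichoose-pascal zero    j = trans (nCn≡1 (suc j)) (sym (cong (_+ 0) (nCn≡1 j)))
multichoose-pascal (suc q) j = begin
  (suc q + suc j) C suc j                   ≡⟨ cong (_C suc j) (+-suc (suc q) j) ⟩
  suc (suc q + j) C suc j                   ≡⟨ nCk+nC[k+1]≡[n+1]C[k+1] (suc q + j) j ⟨
  (suc q + j) C j + (suc q + j) C suc j     ≡⟨ cong (λ n → (suc q + j) C j + n C suc j) (+-suc q j) ⟨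
  (suc q + j) C j + (q + suc j) C suc j     ∎
  where open ≡-Reasoning

multichoose-suc : ∀ q j → multichoose q (suc j) * suc j ≡ multichoose q j * (q + j)
multichoose-suc zero    zero    = refl
multichoose-suc zero    (suc j) = refl
multichoose-suc (suc q) j = begin
  ((q + suc j) C suc j) * suc j     ≡⟨ cong (λ n → (n C suc j) * suc j) (+-suc q j) ⟩
  (suc (q + j) C suc j) * suc j     ≡⟨ *-comm _ (suc j) ⟩
  suc j * (suc (q + j) C suc j)     ≡⟨ [1+k]*[1+n]C[1+k]≡[1+n]*nCk (q + j) j ⟩
  suc (q + j) * ((q + j) C j)       ≡⟨ *-comm (suc (q + j)) _ ⟩
  ((q + j) C j) * (suc q + j)       ∎
  where open ≡-Reasoning

multichoose*q≤multichoose-suc*[1+j] : ∀ q j → multichoose q j * q ≤ multichoose q (suc j) * suc j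
multichoose*q≤multichoose-suc*[1+j] q j =
  ≤-trans (*-monoʳ-≤ (multichoose q j) (m≤m+n q j)) (≤-reflexive (sym (multichoose-suc q j)))

0≤*0≤ : ∀ {a b} → 0ℚ ℚ.≤ a → 0ℚ ℚ.≤ b → 0ℚ ℚ.≤ a ℚ.* b
0≤*0≤ {a} {b} 0≤a 0≤b = subst (ℚ._≤ a ℚ.* b) (ℚP.*-zeroˡ b) (ℚP.*-monoʳ-≤-nonNeg b {{ℚ.nonNegative 0≤b}} 0≤a)

*-monoʳ-≤-0≤ : ∀ {a b} r → 0ℚ ℚ.≤ r → a ℚ.≤ b → a ℚ.* r ℚ.≤ b ℚ.* r
*-monoʳ-≤-0≤ r 0≤r = ℚP.*-monoʳ-≤-nonNeg r {{ℚ.nonNegative 0≤r}}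

*-monoˡ-≤-0≤ : ∀ {a b} r → 0ℚ ℚ.≤ r → a ℚ.≤ b → r ℚ.* a ℚ.≤ r ℚ.* b
*-monoˡ-≤-0≤ r 0≤r = ℚP.*-monoˡ-≤-nonNeg r {{ℚ.nonNegative 0≤r}}

0≤expTerm : ∀ x → 0ℚ ℚ.≤ x → ∀ j → 0ℚ ℚ.≤ expTerm x j
0≤expTerm x 0≤x zero    = 0≤÷ 1 1
0≤expTerm x 0≤x (suc j) = 0≤*0≤ (0≤*0≤ (0≤expTerm x 0≤x j) 0≤x) (0≤÷ 1 (suc j))

0≤expPartial : ∀ x → 0ℚ ℚ.≤ x → ∀ N → 0ℚ ℚ.≤ expPartial x N
0≤expPartial x 0≤x zero    = ℚP.≤-refl
0≤expPartial x 0≤x (suc N) = subst (ℚ._≤ expPartial x N ℚ.+ expTerm x N) (ℚP.+-identityˡ 0ℚ)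
                                   (ℚP.+-mono-≤ (0≤expPartial x 0≤x N) (0≤expTerm x 0≤x N))

-- partial q N is a partial sum of Σ_j multichoose q j / d^j = (1 - 1/d)^(-q) = ρ^(-q).
module NegativeBinomialSeries (d₀ : ℕ) where

  d : ℕ
  d = suc d₀

  d^≢0 : ∀ j → ℕ.NonZero (d ^ j)
  d^≢0 j = m^n≢0 d j

  y ρ : ℚ
  y = 1 ÷ d
  ρ = d₀ ÷ d

  term : ℕ → ℕ → ℚ
  term q j = (multichoose q j ÷ d ^ j) {{d^≢0 j}}

  partial : ℕ → ℕ → ℚ
  partial q zero    = 0ℚ
  partial q (suc N) = partial q N ℚ.+ term q N

  partial≤partial-suc : ∀ q N → partial q N ℚ.≤ partial q (suc N)
  partial≤partial-suc q N = subst (ℚ._≤ partial q (suc N)) (ℚP.+-identityʳ (partial q N))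
                                  (ℚP.+-monoʳ-≤ (partial q N) (0≤÷ (multichoose q N) (d ^ N) {{d^≢0 N}}))

  term-pascal : ∀ q N → term (suc q) (suc N) ≡ term q (suc N) ℚ.+ y ℚ.* term (suc q) N
  term-pascal q N = begin
    term (suc q) (suc N)
      ≡⟨ ÷-cong (multichoose (suc q) (suc N)) P (b * P + (1 * a) * P) (P * P) {{d^≢0 (suc N)}} {{P*P≢0}} pascal ⟩
    ((b * P + (1 * a) * P) ÷ (P * P)) {{P*P≢0}}   ≡⟨ ÷-+ b P (1 * a) P {{d^≢0 (suc N)}} {{d^≢0 (suc N)}} ⟨
    term q (suc N) ℚ.+ ((1 * a) ÷ P) {{d^≢0 (suc N)}}
                                                  ≡⟨ cong (term q (suc N) ℚ.+_) (÷-* 1 d a (d ^ N) {{_}} {{d^≢0 N}}) ⟨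
    term q (suc N) ℚ.+ y ℚ.* term (suc q) N                 ∎
    where
    open ≡-Reasoning
    P = d ^ suc N
    a = multichoose (suc q) N
    b = multichoose q (suc N)
    P*P≢0 : ℕ.NonZero (P * P)
    P*P≢0 = m*n≢0 P P {{d^≢0 (suc N)}} {{d^≢0 (suc N)}}
    regroup : ∀ a b P → (a + b) * (P * P) ≡ (b * P + (1 * a) * P) * P
    regroup = solve-∀
    pascal : multichoose (suc q) (suc N) * (P * P) ≡ (b * P + (1 * a) * P) * P
    pascal = trans (cong (_* (P * P)) (multichoose-pascal q N)) (regroup a b P)

  partial-pascal : ∀ q N → partial (suc q) (suc N) ≡ partial q (suc N) ℚ.+ y ℚ.* partial (suc q) N
  partial-pascal q zero    = trans (cong (0ℚ ℚ.+_) term-zero) (pad (term q 0) y)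
    where
    term-zero : term (suc q) 0 ≡ term q 0
    term-zero = cong (_÷ 1) (sym (multichoose-zero q))
    pad : ∀ a y → 0ℚ ℚ.+ a ≡ (0ℚ ℚ.+ a) ℚ.+ y ℚ.* 0ℚ
    pad = ℚ-solve-∀ ℚ-ring
  partial-pascal q (suc N) = begin
    partial (suc q) (suc N) ℚ.+ term (suc q) (suc N)
      ≡⟨ cong₂ ℚ._+_ (partial-pascal q N) (term-pascal q N) ⟩
    (partial q (suc N) ℚ.+ y ℚ.* partial (suc q) N) ℚ.+ (term q (suc N) ℚ.+ y ℚ.* term (suc q) N)
      ≡⟨ regroup (partial q (suc N)) y (partial (suc q) N) (term q (suc N)) (term (suc q) N) ⟩
    (partial q (suc N) ℚ.+ term q (suc N)) ℚ.+ y ℚ.* (partial (suc q) N ℚ.+ term (suc q) N) ∎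
    where
    open ≡-Reasoning
    regroup : ∀ A y b T τ → (A ℚ.+ y ℚ.* b) ℚ.+ (T ℚ.+ y ℚ.* τ) ≡ (A ℚ.+ T) ℚ.+ y ℚ.* (b ℚ.+ τ)
    regroup = ℚ-solve-∀ ℚ-ring

  ρ+y≡1 : ρ ℚ.+ y ≡ 1ℚ
  ρ+y≡1 = trans (÷-+ d₀ d 1 d) (÷-cong (d₀ * d + 1 * d) (d * d) 1 1 (expand d₀))
    where
    expand : ∀ d₀ → (d₀ * suc d₀ + 1 * suc d₀) * 1 ≡ 1 * (suc d₀ * suc d₀)
    expand = solve-∀

  ρ*partial-suc≤partial : ∀ q N → ρ ℚ.* partial (suc q) N ℚ.≤ partial q N
  ρ*partial-suc≤partial q zero    = ℚP.≤-reflexive (ℚP.*-zeroʳ ρ)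
  ρ*partial-suc≤partial q (suc N) = begin
    ρ ℚ.* B′                              ≡⟨ split ρ y B′ ⟩
    (ρ ℚ.+ y) ℚ.* B′ ℚ.- y ℚ.* B′         ≡⟨ cong (λ z → z ℚ.* B′ ℚ.- y ℚ.* B′) ρ+y≡1 ⟩
    1ℚ ℚ.* B′ ℚ.- y ℚ.* B′                ≡⟨ cong (λ z → 1ℚ ℚ.* z ℚ.- y ℚ.* B′) (partial-pascal q N) ⟩
    1ℚ ℚ.* (A ℚ.+ y ℚ.* b) ℚ.- y ℚ.* B′   ≡⟨ regroup A y b (y ℚ.* B′) ⟩
    A ℚ.+ (y ℚ.* b ℚ.- y ℚ.* B′)
      ≤⟨ ℚP.+-monoʳ-≤ A (ℚP.+-monoˡ-≤ (ℚ.- (y ℚ.* B′))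
                        (*-monoˡ-≤-0≤ y (0≤÷ 1 d) (partial≤partial-suc (suc q) N))) ⟩
    A ℚ.+ (y ℚ.* B′ ℚ.- y ℚ.* B′)         ≡⟨ cancel A (y ℚ.* B′) ⟩
    A                                     ∎
    where
    open ℚP.≤-Reasoning
    B′ = partial (suc q) (suc N)
    A = partial q (suc N)
    b = partial (suc q) N
    split : ∀ ρ y B → ρ ℚ.* B ≡ (ρ ℚ.+ y) ℚ.* B ℚ.- y ℚ.* B
    split = ℚ-solve-∀ ℚ-ring
    regroup : ∀ A y b z → 1ℚ ℚ.* (A ℚ.+ y ℚ.* b) ℚ.- z ≡ A ℚ.+ (y ℚ.* b ℚ.- z)
    regroup = ℚ-solve-∀ ℚ-ring
    cancel : ∀ A z → A ℚ.+ (z ℚ.- z) ≡ A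
    cancel = ℚ-solve-∀ ℚ-ring

  ρ^_ : ℕ → ℚ
  ρ^ q = (d₀ ^ q ÷ d ^ q) {{d^≢0 q}}

  partial-zero≤1 : ∀ N → partial 0 N ℚ.≤ 1ℚ
  partial-zero≤1 zero    = ÷-mono-≤ 0 1 1 1 z≤n
  partial-zero≤1 (suc N) = ℚP.≤-reflexive (partial-zero-suc N)
    where
    partial-zero-suc : ∀ N → partial 0 (suc N) ≡ 1ℚ
    partial-zero-suc zero    = ℚP.+-identityˡ 1ℚ
    partial-zero-suc (suc N) = trans (cong₂ ℚ._+_ (partial-zero-suc N) (÷-cong 0 (d ^ suc N) 0 1 {{d^≢0 (suc N)}} refl))
                                     (ℚP.+-identityʳ 1ℚ)

  ρ^q*partial≤1 : ∀ q N → ρ^ q ℚ.* partial q N ℚ.≤ 1ℚ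
  ρ^q*partial≤1 zero    N = subst (ℚ._≤ 1ℚ) (sym (ℚP.*-identityˡ (partial 0 N))) (partial-zero≤1 N)
  ρ^q*partial≤1 (suc q) N = begin
    ρ^ suc q ℚ.* partial (suc q) N
      ≡⟨ cong (ℚ._* partial (suc q) N) (÷-* d₀ d (d₀ ^ q) (d ^ q) {{_}} {{d^≢0 q}}) ⟨
    (ρ ℚ.* ρ^ q) ℚ.* partial (suc q) N     ≡⟨ swap ρ (ρ^ q) (partial (suc q) N) ⟩
    ρ^ q ℚ.* (ρ ℚ.* partial (suc q) N)
      ≤⟨ *-monoˡ-≤-0≤ (ρ^ q) (0≤÷ (d₀ ^ q) (d ^ q) {{d^≢0 q}}) (ρ*partial-suc≤partial q N) ⟩
    ρ^ q ℚ.* partial q N                   ≤⟨ ρ^q*partial≤1 q N ⟩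
    1ℚ                                     ∎
    where
    open ℚP.≤-Reasoning
    swap : ∀ a b c → (a ℚ.* b) ℚ.* c ≡ b ℚ.* (a ℚ.* c)
    swap = ℚ-solve-∀ ℚ-ring

  expTerm≤term : ∀ q j → expTerm (q ÷ d) j ℚ.≤ term q j
  expTerm≤term q zero    = ℚP.≤-reflexive (cong (_÷ 1) (sym (multichoose-zero q)))
  expTerm≤term q (suc j) = begin
    expTerm x j ℚ.* x ℚ.* (1 ÷ suc j)
      ≤⟨ *-monoʳ-≤-0≤ (1 ÷ suc j) (0≤÷ 1 (suc j)) (*-monoʳ-≤-0≤ x (0≤÷ q d) (expTerm≤term q j)) ⟩
    term q j ℚ.* x ℚ.* (1 ÷ suc j)
      ≡⟨ cong (ℚ._* (1 ÷ suc j)) (÷-* (multichoose q j) (d ^ j) q d {{d^≢0 j}} {{_}}) ⟩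
    ((multichoose q j * q) ÷ (d ^ j * d)) {{≢0}} ℚ.* (1 ÷ suc j)
      ≡⟨ ÷-* (multichoose q j * q) (d ^ j * d) 1 (suc j) {{≢0}} {{_}} ⟩
    ((multichoose q j * q * 1) ÷ (d ^ j * d * suc j)) {{≢0′}}
      ≤⟨ ÷-mono-≤ (multichoose q j * q * 1) (d ^ j * d * suc j) (multichoose q (suc j)) (d ^ suc j)
                  {{≢0′}} {{d^≢0 (suc j)}} cross ⟩
    term q (suc j) ∎
    where
    open ℚP.≤-Reasoning
    x = q ÷ d
    ≢0 = m*n≢0 (d ^ j) d {{d^≢0 j}}
    ≢0′ = m*n≢0 (d ^ j * d) (suc j) {{≢0}}
    regroup : ∀ a b P d → a * 1 * (d * P) ≡ a * (P * d)
    regroup = solve-∀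
    regroup′ : ∀ c s P d → c * s * (P * d) ≡ c * (P * d * s)
    regroup′ = solve-∀
    cross : multichoose q j * q * 1 * d ^ suc j ≤ multichoose q (suc j) * (d ^ j * d * suc j)
    cross = subst₂ _≤_ (sym (regroup (multichoose q j * q) (suc j) (d ^ j) d)) (regroup′ (multichoose q (suc j)) (suc j) (d ^ j) d)
                   (*-monoˡ-≤ (d ^ j * d) (multichoose*q≤multichoose-suc*[1+j] q j))

  expPartial≤partial : ∀ q N → expPartial (q ÷ d) N ℚ.≤ partial q N
  expPartial≤partial q zero    = ℚP.≤-refl
  expPartial≤partial q (suc N) = ℚP.+-mono-≤ (expPartial≤partial q N) (expTerm≤term q N)

-- The two bounds

countE*D≤mCk*D^m : ∀ u m k → 1 ≤ k → countE u m k * D u ≤ (m C k) * D u ^ m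
countE*D≤mCk*D^m u m (suc k) _ = begin
  countE u m (suc k) * D u                ≡⟨ cong (_* D u) (countE≡ΣCube u m (suc k)) ⟩
  ΣCube u m (χ ∘ E (suc k)) * D u         ≤⟨ *-monoˡ-≤ (D u) (ΣCube-mono u m union-bound) ⟩
  ΣCube u m (zeroSums m (suc k)) * D u    ≤⟨ ΣCube-zeroSums≤ u m k ⟩
  (m C suc k) * D u ^ m                   ∎
  where
  open ≤-Reasoning
  union-bound : ∀ v → InCube u m v → χ (E (suc k) v) ≤ zeroSums m (suc k) v
  union-bound v c = subst (λ n → χ (E (suc k) v) ≤ zeroSums n (suc k) v) (InCube-length u m v c) (χE≤zeroSums (suc k) v)

PrE≤mCk/D : ∀ u m k → 1 ≤ k → PrE u m k ℚ.≤ (m C k) ÷ D u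
PrE≤mCk/D u m k 1≤k = ÷-mono-≤ (countE u m k) (D u ^ m) (m C k) (D u) {{m^n≢0 (D u) m}} (countE*D≤mCk*D^m u m k 1≤k)

failures-total : ∀ u m k q → 1 ≤ k → (q * k) ^ k * (20 * u + 10) ≤ m ^ k →
                 failures u k m * suc (suc (4 * k)) ^ q ≤ D u ^ m * suc (4 * k) ^ q
failures-total u m k zero    _   _   =
  subst₂ _≤_ (sym (*-identityʳ (failures u k m))) (sym (*-identityʳ (D u ^ m))) (failures≤ u k m)
failures-total u m k (suc q) 1≤k hyp =
  let n , r , m≡qn+r , D≤C = block-decomposition u m k (suc q) {{ℕ.>-nonZero 1≤k}} hyp
  in  failures-bound u k m n (suc q) r m≡qn+r 1≤k D≤C

module _ (u m k q : ℕ) (1≤k : 1 ≤ k) (hyp : (q * k) ^ k * (20 * u + 10) ≤ m ^ k) where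

  open NegativeBinomialSeries (suc (4 * k))

  1-PrE≤ρ^q : 1ℚ ℚ.- PrE u m k ℚ.≤ ρ^ q
  1-PrE≤ρ^q = subst₂ ℚ._≤_ refl (cancel (ρ^ q) (PrE u m k)) (ℚP.+-monoˡ-≤ (ℚ.- PrE u m k) 1≤ρ^q+PrE)
    where
    c = countE u m k
    G = failures u k m
    instance
      D^m≢0 : ℕ.NonZero (D u ^ m)
      D^m≢0 = m^n≢0 (D u) m
    G+c≡D^m : G + c ≡ D u ^ m
    G+c≡D^m = trans (cong (G +_) (countE≡ΣCube u m k)) (failures+successes u k m)
    expand : ∀ D g c → 1 * (D * (g + c)) ≡ g * D + c * D
    expand = solve-∀
    regroup : ∀ Dm a b → Dm * a + b ≡ (a * Dm + b) * 1
    regroup = solve-∀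
    cross : 1 * (d ^ q * D u ^ m) ≤ (suc (4 * k) ^ q * D u ^ m + c * d ^ q) * 1
    cross = begin
      1 * (d ^ q * D u ^ m)               ≡⟨ cong (λ z → 1 * (d ^ q * z)) G+c≡D^m ⟨
      1 * (d ^ q * (G + c))               ≡⟨ expand (d ^ q) G c ⟩
      G * d ^ q + c * d ^ q               ≤⟨ +-monoˡ-≤ (c * d ^ q) (failures-total u m k q 1≤k hyp) ⟩
      D u ^ m * suc (4 * k) ^ q + c * d ^ q        ≡⟨ regroup (D u ^ m) (suc (4 * k) ^ q) (c * d ^ q) ⟩
      (suc (4 * k) ^ q * D u ^ m + c * d ^ q) * 1  ∎
      where open ≤-Reasoning
    1≤ρ^q+PrE : 1ℚ ℚ.≤ ρ^ q ℚ.+ PrE u m k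
    1≤ρ^q+PrE = subst (1ℚ ℚ.≤_) (sym (÷-+ (suc (4 * k) ^ q) (d ^ q) c (D u ^ m) {{d^≢0 q}}))
                      (÷-mono-≤ 1 1 (suc (4 * k) ^ q * D u ^ m + c * d ^ q) (d ^ q * D u ^ m)
                                {{_}} {{m*n≢0 (d ^ q) (D u ^ m) {{d^≢0 q}}}} cross)
    cancel : ∀ R P → R ℚ.+ P ℚ.- P ≡ R
    cancel = ℚ-solve-∀ ℚ-ring

  [1-PrE]*expPartial≤1 : ∀ N → (1ℚ ℚ.- PrE u m k) ℚ.* expPartial (q ÷ d) N ℚ.≤ 1ℚ
  [1-PrE]*expPartial≤1 N = begin
    (1ℚ ℚ.- PrE u m k) ℚ.* expPartial (q ÷ d) N
      ≤⟨ *-monoʳ-≤-0≤ _ (0≤expPartial (q ÷ d) (0≤÷ q d) N) 1-PrE≤ρ^q ⟩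
    ρ^ q ℚ.* expPartial (q ÷ d) N
      ≤⟨ *-monoˡ-≤-0≤ (ρ^ q) (0≤÷ (suc (4 * k) ^ q) (d ^ q) {{d^≢0 q}}) (expPartial≤partial q N) ⟩
    ρ^ q ℚ.* partial q N                         ≤⟨ ρ^q*partial≤1 q N ⟩
    1ℚ                                           ∎
    where open ℚP.≤-Reasoning

open import Data.Integer using (+_)

lemma3p4 : (u m k : ℕ) → 1 ≤ u → 2 ≤ k → k ≤ m →
    -- q = ⌊ m / (k (20u+10)^(1/k)) ⌋, characterised by q ≤ m/(k r) < q+1 with r^k = 20u+10
    (q : ℕ) → (q * k) ^ k * (20 * u + 10) ≤ m ^ k → m ^ k < ((suc q) * k) ^ k * (20 * u + 10) →
    -- lower bound 1 - exp(-α) ≤ Pr[E_k], α = q/(4k+2), i.e. (1 - Pr[E_k]) exp(α) ≤ 1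
    ((N : ℕ) → (1ℚ ℚ.- PrE u m k) ℚ.* expPartial (+ q / suc (suc (4 * k))) N ℚ.≤ 1ℚ)
    -- upper bound Pr[E_k] ≤ C(m,k)/(2u+1)
    × PrE u m k ℚ.≤ + (m C k) / suc (2 * u)
lemma3p4 u m k _ 2≤k _ q hyp _ = [1-PrE]*expPartial≤1 u m k q 1≤k hyp , PrE≤mCk/D u m k 1≤k
  where
  1≤k : 1 ≤ k
  1≤k = ≤-trans (s≤s z≤n) 2≤k
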